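{- Let $r\ge2$. For $n\ge0$ let $N_n$ be the number of $B_n$-partitions without zero-block, and let $N_{n,r}^D$ be the number of ordered $r$-tuples $(\pi_1,\ldots,\pi_r)$ of $B_n$-partitions without zero-block that intersect minimally (with $N_0=N_{0,r}^D=1$). Then for every $n\ge1$, \[ N_{n,r}^D=\sum_{j=1}^{n}N_j^r\,2^{n-j}\,s(n,j), \] where $s(n,j)$ are the (signed) Stirling numbers of the first kind. Moreover, with $M_r^D(x)=\sum_{n\ge0}N_{n,r}^D\frac{x^n}{n!}$, one has the formal power series identity \[ M_r^D\!\left(\frac{e^{2x}-1}{2}\right)=\sum_{n\ge0}N_n^r\frac{x^n}{n!}. \]
   Context: Let $[\pm n]=\{\pm1,\ldots,\pm n\}$. A $B_n$-partition is a partition of $[\pm n]$ into blocks such that (i) for every block $B$, $-B=\{ -b:b\in B\}$ is also a block, and (ii) there is at most one block $B$ with $B=-B$, called the zero-block. The meet $\pi_1\wedge\cdots\wedge\pi_r$ (in the refinement order) is the partition whose blocks are the nonempty intersections $B_1\cap\cdots\cap B_r$ with $B_t$ a block of $\pi_t$; $\hat0^B=\{\{1\},\{ -1\},\ldots,\{n\},\{ -n\}\}$. The partitions intersect minimally if their meet is $\hat0^B$. The signed Stirling numbers of the first kind are defined by $x(x-1)\cdots(x-n+1)=\sum_{j}s(n,j)x^j$. -}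

module Defs where

open import Data.Bool using (Bool; true; false; _∧_; _∨_; not; if_then_else_)
open import Data.Nat as ℕ using (ℕ; zero; suc; _∸_; _!; _^_; _≡ᵇ_)
open import Data.Nat.Properties using (_!≢0)
open import Data.Fin as Fin using (Fin; _↑ˡ_; _↑ʳ_; splitAt; _≟_)
open import Data.Sum using ([_,_]′)
open import Data.List using (List; []; _∷_; map; concatMap; length; filterᵇ; upTo; foldr)
open import Data.Integer as ℤ using (ℤ; +_)
open import Data.Rational as ℚ using (ℚ; 0ℚ; 1ℚ)
open import Relation.Nullary.Decidable using (⌊_⌋)

-- Signed ground set [±n].
-- Elements are Fin (n + n): (i ↑ˡ n) encodes +(i+1), (n ↑ʳ i) encodes -(i+1).

Elt : ℕ → Set
Elt n = Fin (n ℕ.+ n)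

neg : (n : ℕ) → Elt n → Elt n
neg n x = [ (λ i → n ↑ʳ i) , (λ i → i ↑ˡ n) ]′ (splitAt n x)

allF : ∀ {m} → (Fin m → Bool) → Bool
allF {zero}  p = true
allF {suc m} p = p Fin.zero ∧ allF (λ i → p (Fin.suc i))

_⇒ᵇ_ : Bool → Bool → Bool
a ⇒ᵇ b = not a ∨ b

eqᵇ : ∀ {m} → Fin m → Fin m → Bool
eqᵇ x y = ⌊ x ≟ y ⌋

-- A partition of [±n] is represented by its equivalence relation
-- "x and y lie in the same block" (a Bool-valued relation).

Rel : ℕ → Set
Rel n = Elt n → Elt n → Bool

isEquivalence : (n : ℕ) → Rel n → Bool
isEquivalence n R =
  allF {n ℕ.+ n} (λ x → R x x) ∧
  allF {n ℕ.+ n} (λ x → allF {n ℕ.+ n} (λ y → R x y ⇒ᵇ R y x)) ∧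
  allF {n ℕ.+ n} (λ x → allF {n ℕ.+ n} (λ y → allF {n ℕ.+ n} (λ z → (R x y ∧ R y z) ⇒ᵇ R x z)))

-- (i) for every block B, -B is a block: x ~ y implies -x ~ -y
negClosed : (n : ℕ) → Rel n → Bool
negClosed n R = allF {n ℕ.+ n} (λ x → allF {n ℕ.+ n} (λ y → R x y ⇒ᵇ R (neg n x) (neg n y)))

-- x lies in a block B with B = -B   iff   x ~ -x
-- (ii) at most one zero-block: any two such elements are in the same block
atMostOneZeroBlock : (n : ℕ) → Rel n → Bool
atMostOneZeroBlock n R =
  allF {n ℕ.+ n} (λ x → allF {n ℕ.+ n} (λ y → (R x (neg n x) ∧ R y (neg n y)) ⇒ᵇ R x y))

isBPartition : (n : ℕ) → Rel n → Bool
isBPartition n R = isEquivalence n R ∧ negClosed n R ∧ atMostOneZeroBlock n R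

noZeroBlock : (n : ℕ) → Rel n → Bool
noZeroBlock n R = allF {n ℕ.+ n} (λ x → not (R x (neg n x)))

consF : ∀ {A : Set} {m} → A → (Fin m → A) → Fin (suc m) → A
consF a f Fin.zero    = a
consF a f (Fin.suc i) = f i

allFuns : ∀ {A : Set} (m : ℕ) → List A → List (Fin m → A)
allFuns zero    xs = (λ ()) ∷ []
allFuns (suc m) xs = concatMap (λ a → map (consF a) (allFuns m xs)) xs

allRels : (n : ℕ) → List (Rel n)
allRels n = allFuns (n ℕ.+ n) (allFuns (n ℕ.+ n) (true ∷ false ∷ []))

BPartsNZ : (n : ℕ) → List (Rel n)
BPartsNZ n = filterᵇ (λ R → isBPartition n R ∧ noZeroBlock n R) (allRels n)

N : ℕ → ℕ
N n = length (BPartsNZ n)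

meet : (n r : ℕ) → (Fin r → Rel n) → Rel n
meet n r π x y = allF (λ t → π t x y)

minimallyIntersecting : (n r : ℕ) → (Fin r → Rel n) → Bool
minimallyIntersecting n r π =
  allF {n ℕ.+ n} (λ x → allF {n ℕ.+ n} (λ y → meet n r π x y ⇒ᵇ eqᵇ x y))

ND : ℕ → ℕ → ℕ
ND n r = length (filterᵇ (minimallyIntersecting n r) (allFuns r (BPartsNZ n)))

-- Signed Stirling numbers of the first kind: s(n,j) is the coefficient
-- of x^j in x(x-1)...(x-n+1). Polynomials = coefficient functions ℕ → ℤ.

Poly : Set
Poly = ℕ → ℤ

mulXminus : ℕ → Poly → Poly
mulXminus k p zero    = ℤ.- ((+ k) ℤ.* p zero)
mulXminus k p (suc j) = p j ℤ.- ((+ k) ℤ.* p (suc j))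

fallingFactorial : ℕ → Poly
fallingFactorial zero    zero    = + 1
fallingFactorial zero    (suc j) = + 0
fallingFactorial (suc n) = mulXminus n (fallingFactorial n)

s : ℕ → ℕ → ℤ
s n j = fallingFactorial n j

-- Σ_{j=1}^{n} f j  over ℤ
sumℤ1 : ℕ → (ℕ → ℤ) → ℤ
sumℤ1 n f = foldr ℤ._+_ (+ 0) (map (λ i → f (suc i)) (upTo n))

FPS : Set
FPS = ℕ → ℚ

-- Σ_{k=0}^{m} f k  over ℚ
sumℚ0 : ℕ → (ℕ → ℚ) → ℚ
sumℚ0 m f = foldr ℚ._+_ 0ℚ (map f (upTo (suc m)))

oneS : FPS
oneS zero    = 1ℚ
oneS (suc _) = 0ℚ

_-S_ : FPS → FPS → FPS
(f -S g) m = f m ℚ.- g m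

scaleS : ℚ → FPS → FPS
scaleS c f m = c ℚ.* f m

_*S_ : FPS → FPS → FPS
(f *S g) m = sumℚ0 m (λ k → f k ℚ.* g (m ∸ k))

powS : FPS → ℕ → FPS
powS f zero    = oneS
powS f (suc k) = f *S powS f k

-- composition F(G(x)) for G with zero constant term:
-- [x^m] F(G) = Σ_{n=0}^{m} F_n [x^m] G^n  (G^n has order ≥ n)
composeS : FPS → FPS → FPS
composeS F G m = sumℚ0 m (λ n → F n ℚ.* powS G n m)

egf : (ℕ → ℕ) → FPS
egf a n = ((+ a n) ℚ./ (n !)) {{n !≢0}}

exp2x : FPS
exp2x = egf (λ n → 2 ^ n)

halfExp2xMinus1 : FPS
halfExp2xMinus1 = scaleS ((+ 1) ℚ./ 2) (exp2x -S oneS)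

MD : ℕ → FPS
MD r = egf (λ n → ND n r)

-- Every r-tuple of B_n-partitions without zero block has a meet of the same kind. If the meet has
-- j pairs of blocks {B, -B}, collapsing its blocks turns the tuple into a minimally intersecting
-- r-tuple on [±j], and conversely; so N_n^r = Σ_j T(n,j) N^D_{j,r}, where T(n,j) = 2^(n-j) S(n,j)
-- counts the B_n-partitions without zero block with j block pairs. To prove this, count tuples on
-- c "constrained" elements, which the meet must isolate, and m "free" ones whose meet has j block
-- pairs, and peel off one free element: either the meet isolates it, and it becomes constrained, or
-- it joins one of the 2j blocks, which is the recursion of T. Finally, the matrices T(n,j) and
-- 2^(n-j) s(n,j) are mutually inverse, giving the first formula, and the k-th column of T has
-- exponential generating function ((e^(2x) - 1)/2)^k / k!, giving the second.

module Submission where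

open import Algebra.Bundles using (CommutativeSemiring)
import Data.Nat
import Data.Nat.Properties

module FiniteSum {c ℓ} (R : CommutativeSemiring c ℓ) where

  open import Data.Bool using (if_then_else_)
  open import Data.Fin using (toℕ)
  open import Data.List using (foldr; map; applyUpTo)
  open import Data.Nat as ℕ using (ℕ; zero; suc; _<_; _≤_; _≡ᵇ_; z≤n; s≤s; z<s; s<s)
  open import Function using (_∘_)
  open import Relation.Binary.PropositionalEquality as ≡ using (_≢_)
  open import Relation.Nullary using (contradiction)

  open CommutativeSemiring R
  open import Algebra.Properties.Semiring.Sum semiring
    using (sum; sum-cong-≋; sum-replicate-zero; ∑-distrib-+; ∑-comm; *-distribˡ-sum; *-distribʳ-sum)
  open import Relation.Binary.Reasoning.Setoid setoid

  ∑ : ℕ → (ℕ → Carrier) → Carrier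
  ∑ K f = sum {K} (f ∘ toℕ)

  ∑-cong : ∀ K {f g} → (∀ j → f j ≈ g j) → ∑ K f ≈ ∑ K g
  ∑-cong K f≈g = sum-cong-≋ {K} (f≈g ∘ toℕ)

  ∑-cong-< : ∀ K {f g} → (∀ j → j < K → f j ≈ g j) → ∑ K f ≈ ∑ K g
  ∑-cong-< zero    f≈g = refl
  ∑-cong-< (suc K) f≈g = +-cong (f≈g 0 z<s) (∑-cong-< K (λ j j<K → f≈g (suc j) (s<s j<K)))

  ∑-0 : ∀ K → ∑ K (λ _ → 0#) ≈ 0#
  ∑-0 = sum-replicate-zero

  ∑-vanish : ∀ K {f} → (∀ j → f j ≈ 0#) → ∑ K f ≈ 0#
  ∑-vanish K f≈0 = trans (∑-cong K f≈0) (∑-0 K)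

  ∑-+ : ∀ K (f g : ℕ → Carrier) → ∑ K (λ j → f j + g j) ≈ ∑ K f + ∑ K g
  ∑-+ K f g = ∑-distrib-+ {K} (f ∘ toℕ) (g ∘ toℕ)

  *-distribˡ-∑ : ∀ K x (f : ℕ → Carrier) → x * ∑ K f ≈ ∑ K (λ j → x * f j)
  *-distribˡ-∑ K x f = *-distribˡ-sum {K} x (f ∘ toℕ)

  *-distribʳ-∑ : ∀ K x (f : ℕ → Carrier) → ∑ K f * x ≈ ∑ K (λ j → f j * x)
  *-distribʳ-∑ K x f = *-distribʳ-sum {K} x (f ∘ toℕ)

  ∑-swap : ∀ K L (f : ℕ → ℕ → Carrier) → ∑ K (λ i → ∑ L (f i)) ≈ ∑ L (λ j → ∑ K (λ i → f i j))
  ∑-swap K L f = ∑-comm {K} {L} (λ i j → f (toℕ i) (toℕ j))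

  ∑-extend : ∀ {A B} (f : ℕ → Carrier) → A ≤ B → (∀ j → A ≤ j → f j ≈ 0#) → ∑ A f ≈ ∑ B f
  ∑-extend {zero}  {B}     f z≤n       f≈0 = sym (∑-vanish B (λ j → f≈0 j z≤n))
  ∑-extend {suc A} {suc B} f (s≤s A≤B) f≈0 = +-congˡ (∑-extend (f ∘ suc) A≤B (λ j A≤j → f≈0 (suc j) (s≤s A≤j)))

  δ : ℕ → ℕ → Carrier
  δ n k = if n ≡ᵇ k then 1# else 0#

  δ-diag : ∀ n → δ n n ≈ 1#
  δ-diag zero    = refl
  δ-diag (suc n) = δ-diag n

  δ-off : ∀ {n k} → n ≢ k → δ n k ≈ 0#
  δ-off {zero}  {zero}  n≢k = contradiction ≡.refl n≢k
  δ-off {zero}  {suc k} _   = refl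
  δ-off {suc n} {zero}  _   = refl
  δ-off {suc n} {suc k} n≢k = δ-off (n≢k ∘ ≡.cong suc)

  ∑-δ : ∀ K n (f : ℕ → Carrier) → n < K → ∑ K (λ k → f k * δ n k) ≈ f n
  ∑-δ (suc K) zero f _ = begin
    f 0 * 1# + ∑ K (λ k → f (suc k) * 0#) ≈⟨ +-cong (*-identityʳ (f 0)) (∑-vanish K (λ k → zeroʳ (f (suc k)))) ⟩
    f 0 + 0#                              ≈⟨ +-identityʳ (f 0) ⟩
    f 0                                   ∎
  ∑-δ (suc K) (suc n) f (s<s n<K) = begin
    f 0 * 0# + ∑ K (λ k → f (suc k) * δ n k) ≈⟨ +-cong (zeroʳ (f 0)) (∑-δ K n (f ∘ suc) n<K) ⟩
    0# + f (suc n)                           ≈⟨ +-identityˡ (f (suc n)) ⟩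
    f (suc n)                                ∎

  foldr-applyUpTo : ∀ n (g : ℕ → Carrier) h → foldr _+_ 0# (map g (applyUpTo h n)) ≈ ∑ n (g ∘ h)
  foldr-applyUpTo zero    g h = refl
  foldr-applyUpTo (suc n) g h = +-congˡ (foldr-applyUpTo n g (h ∘ suc))

module BoolFacts where

  open import Data.Bool using (Bool; true; false; not; _∧_)
  open import Data.Fin using (Fin)
  import Data.Fin as Fin
  open import Data.Empty using (⊥; ⊥-elim)
  open import Data.Nat using (zero; suc)
  open import Function using (_∘_)
  open import Relation.Binary.PropositionalEquality using (_≡_; refl; sym; cong₂)
  open import Defs using (allF; _⇒ᵇ_)

  ∧-elimˡ : ∀ {a b} → a ∧ b ≡ true → a ≡ true
  ∧-elimˡ {true} _ = refl

  ∧-elimʳ : ∀ {a b} → a ∧ b ≡ true → b ≡ true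
  ∧-elimʳ {true} ab = ab

  ∧-intro : ∀ {a b} → a ≡ true → b ≡ true → a ∧ b ≡ true
  ∧-intro = cong₂ _∧_

  ⇒ᵇ-elim : ∀ {a b} → (a ⇒ᵇ b) ≡ true → a ≡ true → b ≡ true
  ⇒ᵇ-elim {true} b refl = b

  ⇒ᵇ-intro : ∀ {a b} → (a ≡ true → b ≡ true) → (a ⇒ᵇ b) ≡ true
  ⇒ᵇ-intro {true}  a⇒b = a⇒b refl
  ⇒ᵇ-intro {false} _   = refl

  not-elim : ∀ {a} → not a ≡ true → a ≡ false
  not-elim {false} _ = refl

  not-intro : ∀ {a} → a ≡ false → not a ≡ true
  not-intro refl = refl

  true≢false : ∀ {a} → a ≡ true → a ≡ false → ⊥
  true≢false refl ()

  not-true-absurd : ∀ {a} → not a ≡ true → a ≡ true → ⊥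
  not-true-absurd {true} () refl

  ¬true⇒not : ∀ {a} → (a ≡ true → ⊥) → not a ≡ true
  ¬true⇒not {true}  ¬a = ⊥-elim (¬a refl)
  ¬true⇒not {false} _  = refl

  bool-ext : ∀ {a b} → (a ≡ true → b ≡ true) → (b ≡ true → a ≡ true) → a ≡ b
  bool-ext {true}  {true}  _ _ = refl
  bool-ext {true}  {false} f _ = sym (f refl)
  bool-ext {false} {true}  _ g = g refl
  bool-ext {false} {false} _ _ = refl

  allF-elim : ∀ {m} {p : Fin m → Bool} → allF p ≡ true → ∀ i → p i ≡ true
  allF-elim {suc m} all Fin.zero    = ∧-elimˡ all
  allF-elim {suc m} all (Fin.suc i) = allF-elim (∧-elimʳ all) i

  allF-intro : ∀ {m} {p : Fin m → Bool} → (∀ i → p i ≡ true) → allF p ≡ true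
  allF-intro {zero} _ = refl
  allF-intro {suc m} all = ∧-intro (all Fin.zero) (allF-intro (all ∘ Fin.suc))

  allF-cong : ∀ {m} {p q : Fin m → Bool} → (∀ i → p i ≡ q i) → allF p ≡ allF q
  allF-cong {zero} _ = refl
  allF-cong {suc m} p≡q = cong₂ _∧_ (p≡q Fin.zero) (allF-cong (p≡q ∘ Fin.suc))

module Enumeration where

  open import Data.Bool using (Bool; true; false; not; T?; if_then_else_)
  open import Data.Bool.Properties using (T-≡)
  open import Data.Fin as Fin using (Fin)
  open import Data.List using (List; []; _∷_; map; length; filterᵇ; concatMap; _++_)
  open import Data.List.Membership.Setoid as Membership using ()
  import Data.List.Membership.Setoid.Properties as ∈
  open import Data.List.Properties using (length-removeAt′; length-++; length-map; map-++; map-∘)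
  open import Data.List.Relation.Unary.All as All using (All; []; _∷_)
  import Data.List.Relation.Unary.All.Properties as All
  open import Data.List.Relation.Unary.Any as Any using (Any; here; there; _─_)
  import Data.List.Relation.Unary.Any.Properties as Any
  open import Data.List.Relation.Unary.AllPairs as AllPairs using (AllPairs; []; _∷_)
  import Data.List.Relation.Unary.AllPairs.Properties as AllPairs
  open import Data.List.Relation.Unary.Unique.Setoid using (Unique)
  open import Data.Nat using (zero; suc; _+_; _*_; _^_; _≤_; z≤n; s≤s)
  open import Data.Nat.Properties using (≤-antisym; +-suc; *-zeroʳ; *-suc; *-comm)
  open import Data.Product using (_×_; _,_)
  open import Data.Product.Relation.Binary.Pointwise.NonDependent using (_×ₛ_)
  open import Data.Sum using (_⊎_; inj₁; inj₂)
  import Data.Sum as Sum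
  open import Function using (_∘_; id; Equivalence)
  open import Function.Indexed.Relation.Binary.Equality using (≡-setoid)
  open import Level using (0ℓ)
  open import Relation.Binary.Bundles using (Setoid)
  import Relation.Binary.Indexed.Heterogeneous.Construct.Trivial as Trivial
  open import Relation.Binary.PropositionalEquality as ≡ using (_≡_; refl; cong; cong₂)
  open import Relation.Nullary using (¬_; contradiction)
  open import Defs using (consF; allFuns)

  _→ₛ_ : Set → Setoid 0ℓ 0ℓ → Setoid 0ℓ 0ℓ
  A →ₛ S = ≡-setoid A (Trivial.indexedSetoid S)

  record Enumerates (S : Setoid 0ℓ 0ℓ) (P : Setoid.Carrier S → Set) (xs : List (Setoid.Carrier S)) : Set where
    open Membership S using (_∈_)
    field
      sound    : All P xs
      complete : ∀ {a} → P a → a ∈ xs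
      unique   : Unique S xs

  open Enumerates public

  module _ {S : Setoid 0ℓ 0ℓ} where

    open Setoid S
    open Membership S using (_∈_)

    private
      ∈-─-split : ∀ {x y ys} (x∈ys : x ∈ ys) → y ∈ ys → x ≈ y ⊎ y ∈ (ys ─ x∈ys)
      ∈-─-split (here x≈z)  (here y≈z)  = inj₁ (trans x≈z (sym y≈z))
      ∈-─-split (here _)    (there y∈ys) = inj₂ y∈ys
      ∈-─-split (there _)   (here y≈z)  = inj₂ (here y≈z)
      ∈-─-split (there x∈ys) (there y∈ys) = Sum.map₂ there (∈-─-split x∈ys y∈ys)

    unique⇒length≤ : ∀ {xs ys} → Unique S xs → All (_∈ ys) xs → length xs ≤ length ys
    unique⇒length≤ [] [] = z≤n
    unique⇒length≤ {ys = ys} (x≉xs ∷ xs!) (x∈ys ∷ xs⊆ys) =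
      ≡.subst (_ ≤_) (≡.sym (length-removeAt′ ys (Any.index x∈ys)))
        (s≤s (unique⇒length≤ xs! (All.zipWith shrink (x≉xs , xs⊆ys))))
      where
      shrink : ∀ {z} → _ ≉ z × z ∈ ys → z ∈ (ys ─ x∈ys)
      shrink (x≉z , z∈ys) = Sum.[ (λ x≈z → contradiction x≈z x≉z) , id ]′ (∈-─-split x∈ys z∈ys)

    Enumerates-length : ∀ {P xs ys} → Enumerates S P xs → Enumerates S P ys → length xs ≡ length ys
    Enumerates-length e f = ≤-antisym
      (unique⇒length≤ (unique e) (All.map (complete f) (sound e)))
      (unique⇒length≤ (unique f) (All.map (complete e) (sound f)))

    Enumerates-⇔ : ∀ {P Q xs} → (∀ {a} → P a → Q a) → (∀ {a} → Q a → P a) → Enumerates S P xs → Enumerates S Q xs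
    Enumerates-⇔ P⇒Q Q⇒P e = record { sound = All.map P⇒Q (sound e) ; complete = complete e ∘ Q⇒P ; unique = unique e }

  record Correspondence (S T : Setoid 0ℓ 0ℓ) (P : Setoid.Carrier S → Set) (Q : Setoid.Carrier T → Set) : Set where
    private
      module S = Setoid S
      module T = Setoid T
    field
      to       : S.Carrier → T.Carrier
      from     : T.Carrier → S.Carrier
      to-cong  : ∀ {a a'} → a S.≈ a' → to a T.≈ to a'
      from-cong : ∀ {b b'} → b T.≈ b' → from b S.≈ from b'
      to-P     : ∀ {a} → P a → Q (to a)
      from-Q   : ∀ {b} → Q b → P (from b)
      from∘to  : ∀ {a} → P a → from (to a) S.≈ a
      to∘from  : ∀ {b} → Q b → to (from b) T.≈ b

  module _ {S T : Setoid 0ℓ 0ℓ} {P Q} (φ : Correspondence S T P Q) where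

    open Correspondence φ
    private
      module S = Setoid S
      module T = Setoid T

    Enumerates-map : ∀ {xs} → Enumerates S P xs → Enumerates T Q (map to xs)
    Enumerates-map {xs} e = record
      { sound    = All.map⁺ (All.map to-P (sound e))
      ; complete = λ q → ∈.∈-resp-≈ T (to∘from q) (∈.∈-map⁺ S T to-cong (complete e (from-Q q)))
      ; unique   = AllPairs.map⁺ (injective (sound e) (unique e))
      }
      where
      injective : ∀ {ys} → All P ys → Unique S ys → AllPairs (λ a a' → ¬ to a T.≈ to a') ys
      injective [] [] = []
      injective (p ∷ ps) (a≉ys ∷ ys!) =
        All.zipWith (λ (p' , a≉a') ta≈ta' → a≉a' (S.trans (S.sym (from∘to p)) (S.trans (from-cong ta≈ta') (from∘to p'))))
          (ps , a≉ys) ∷ injective ps ys!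

  module _ {S : Setoid 0ℓ 0ℓ} where

    open Setoid S
    open Membership S using (_∈_)

    private
      ∈-filterᵇ⁺ : ∀ (p : Carrier → Bool) {a xs} → p a ≡ true → (∀ {b} → a ≈ b → p a ≡ p b) → a ∈ xs → a ∈ filterᵇ p xs
      ∈-filterᵇ⁺ p {xs = x ∷ xs} pa resp (here a≈x) with p x in px
      ... | true  = here a≈x
      ... | false = contradiction (≡.trans (≡.sym pa) (≡.trans (resp a≈x) px)) λ ()
      ∈-filterᵇ⁺ p {xs = x ∷ xs} pa resp (there a∈xs) with p x
      ... | true  = there (∈-filterᵇ⁺ p pa resp a∈xs)
      ... | false = ∈-filterᵇ⁺ p pa resp a∈xs

    Enumerates-filterᵇ : ∀ {P xs} (p : Carrier → Bool) → (∀ {a b} → a ≈ b → p a ≡ p b) →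
      Enumerates S P xs → Enumerates S (λ a → P a × p a ≡ true) (filterᵇ p xs)
    Enumerates-filterᵇ {xs = xs} p resp e = record
      { sound    = All.zipWith (λ (Pa , Tpa) → Pa , Equivalence.to T-≡ Tpa)
                     (All.filter⁺ (T? ∘ p) (sound e) , All.all-filter (T? ∘ p) xs)
      ; complete = λ (Pa , pa) → ∈-filterᵇ⁺ p pa resp (complete e Pa)
      ; unique   = AllPairs.filter⁺ (T? ∘ p) (unique e)
      }

  pairs : ∀ {A B : Set} → (A → List B) → List A → List (A × B)
  pairs L = concatMap (λ a → map (a ,_) (L a))

  length-pairs : ∀ {A B : Set} (L : A → List B) {xs} w → All (λ a → length (L a) ≡ w) xs →
    length (pairs L xs) ≡ w * length xs
  length-pairs L w [] = ≡.sym (*-zeroʳ w)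
  length-pairs L {x ∷ xs} w (|Lx| ∷ |L|) = begin
    length (map (x ,_) (L x) ++ pairs L xs)   ≡⟨ length-++ (map (x ,_) (L x)) ⟩
    length (map (x ,_) (L x)) + length (pairs L xs) ≡⟨ cong₂ _+_ (≡.trans (length-map (x ,_) (L x)) |Lx|) (length-pairs L w |L|) ⟩
    w + w * length xs                         ≡⟨ *-suc w (length xs) ⟨
    w * suc (length xs)                       ∎
    where open ≡.≡-Reasoning

  map-pairs : ∀ {A B C : Set} (f : A × B → C) (L : A → List B) xs →
    map f (pairs L xs) ≡ concatMap (λ a → map (λ b → f (a , b)) (L a)) xs
  map-pairs f L [] = refl
  map-pairs f L (x ∷ xs) = ≡.trans (map-++ f (map (x ,_) (L x)) (pairs L xs))
    (cong₂ _++_ (≡.sym (map-∘ (L x))) (map-pairs f L xs))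

  module _ {S T : Setoid 0ℓ 0ℓ} {P : Setoid.Carrier S → Set} {Q : Setoid.Carrier S → Setoid.Carrier T → Set} where

    private
      module S = Setoid S
      module T = Setoid T
      module ST = Setoid (S ×ₛ T)
      open Membership S using () renaming (_∈_ to _∈S_)
      open Membership T using () renaming (_∈_ to _∈T_)
      open Membership (S ×ₛ T) using () renaming (_∈_ to _∈ST_)

    Enumerates-pairs : ∀ {xs} (L : S.Carrier → List T.Carrier) → Enumerates S P xs →
      (∀ {a} → P a → Enumerates T (Q a) (L a)) → (∀ {a a' b} → a S.≈ a' → Q a b → Q a' b) →
      Enumerates (S ×ₛ T) (λ (a , b) → P a × Q a b) (pairs L xs)
    Enumerates-pairs {xs} L eS eT Q-resp = record
      { sound    = sound-pairs (sound eS)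
      ; complete = λ (Pa , Qab) → ∈.∈-concatMap⁺ S (S ×ₛ T)
                     (Any.map (λ (a≈x , Px) → here-pair a≈x (complete (eT Px) (Q-resp a≈x Qab)))
                       (with-sound (complete eS Pa) (sound eS)))
      ; unique   = unique-pairs (sound eS) (unique eS)
      }
      where
      with-sound : ∀ {a ys} → a ∈S ys → All P ys → Any (λ x → a S.≈ x × P x) ys
      with-sound (here a≈y)  (Py ∷ _)  = here (a≈y , Py)
      with-sound (there a∈ys) (_ ∷ Pys) = there (with-sound a∈ys Pys)
      here-pair : ∀ {a x b} → a S.≈ x → b ∈T L x → (a , b) ∈ST map (x ,_) (L x)
      here-pair a≈x b∈ = Any.map⁺ (Any.map (a≈x ,_) b∈)
      sound-pairs : ∀ {ys} → All P ys → All (λ (a , b) → P a × Q a b) (pairs L ys)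
      sound-pairs [] = []
      sound-pairs (Py ∷ Pys) = All.++⁺ (All.map⁺ (All.map (Py ,_) (sound (eT Py)))) (sound-pairs Pys)
      apart : ∀ {y b ys} → All (y S.≉_) ys → All ((y , b) ST.≉_) (pairs L ys)
      apart [] = []
      apart {ys = z ∷ _} (y≉z ∷ y≉zs) = All.++⁺ (All.map⁺ (All.universal (λ _ (y≈z , _) → y≉z y≈z) (L z))) (apart y≉zs)
      unique-pairs : ∀ {ys} → All P ys → Unique S ys → Unique (S ×ₛ T) (pairs L ys)
      unique-pairs [] [] = []
      unique-pairs {y ∷ ys} (Py ∷ Pys) (y≉ys ∷ ys!) =
        AllPairs.++⁺ (AllPairs.map⁺ (AllPairs.map (λ b≉b' (_ , b≈b') → b≉b' b≈b') (unique (eT Py))))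
          (unique-pairs Pys ys!)
          (All.map⁺ (All.universal (λ _ → apart y≉ys) (L y)))

  module _ {T : Setoid 0ℓ 0ℓ} {Q : Setoid.Carrier T → Set} where

    private
      module T = Setoid T

      uncons : ∀ {K} → T.Carrier × (Fin K → T.Carrier) → Fin (suc K) → T.Carrier
      uncons (b , f) = consF b f

      split-correspondence : ∀ K → Correspondence (T ×ₛ (Fin K →ₛ T)) (Fin (suc K) →ₛ T)
        (λ (b , f) → Q b × (∀ i → Q (f i))) (λ f → ∀ i → Q (f i))
      split-correspondence K = record
        { to        = uncons
        ; from      = λ f → f Fin.zero , f ∘ Fin.suc
        ; to-cong   = λ { (b≈ , f≈) Fin.zero → b≈ ; (b≈ , f≈) (Fin.suc i) → f≈ i }
        ; from-cong = λ f≈ → f≈ Fin.zero , f≈ ∘ Fin.suc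
        ; to-P      = λ { (Qb , Qf) Fin.zero → Qb ; (Qb , Qf) (Fin.suc i) → Qf i }
        ; from-Q    = λ Qf → Qf Fin.zero , Qf ∘ Fin.suc
        ; from∘to   = λ _ → T.refl , λ _ → T.refl
        ; to∘from   = λ { _ Fin.zero → T.refl ; _ (Fin.suc i) → T.refl }
        }

    Enumerates-allFuns : ∀ K {bs} → Enumerates T Q bs → Enumerates (Fin K →ₛ T) (λ f → ∀ i → Q (f i)) (allFuns K bs)
    Enumerates-allFuns zero e = record { sound = (λ ()) ∷ [] ; complete = λ _ → here (λ ()) ; unique = [] ∷ [] }
    Enumerates-allFuns (suc K) {bs} e =
      ≡.subst (Enumerates _ _) (map-pairs uncons (λ _ → allFuns K bs) bs)
        (Enumerates-map (split-correspondence K) (Enumerates-pairs (λ _ → allFuns K bs) e (λ _ → Enumerates-allFuns K e) (λ _ Qf → Qf)))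

  length-allFuns : ∀ {B : Set} K (bs : List B) → length (allFuns K bs) ≡ length bs ^ K
  length-allFuns zero bs = refl
  length-allFuns (suc K) bs = begin
    length (allFuns (suc K) bs)                                   ≡⟨ cong length (map-pairs (λ (b , f) → consF b f) (λ _ → allFuns K bs) bs) ⟨
    length (map (λ (b , f) → consF b f) (pairs (λ _ → allFuns K bs) bs)) ≡⟨ length-map _ (pairs (λ _ → allFuns K bs) bs) ⟩
    length (pairs (λ _ → allFuns K bs) bs)                        ≡⟨ length-pairs (λ _ → allFuns K bs) _ (All.universal (λ _ → refl) bs) ⟩
    length (allFuns K bs) * length bs                             ≡⟨ cong (_* length bs) (length-allFuns K bs) ⟩
    length bs ^ K * length bs                                     ≡⟨ *-comm (length bs ^ K) (length bs) ⟩
    length bs ^ suc K                                             ∎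
    where open ≡.≡-Reasoning

  module _ {A : Set} (p : A → Bool) where

    filterᵇ-none : ∀ {xs} → All (λ a → p a ≡ false) xs → length (filterᵇ p xs) ≡ 0
    filterᵇ-none [] = refl
    filterᵇ-none {x ∷ xs} (px ∷ pxs) with p x
    ... | false = filterᵇ-none pxs
    filterᵇ-none {x ∷ xs} (() ∷ pxs) | true

    length-filterᵇ-split : ∀ xs → length (filterᵇ p xs) + length (filterᵇ (not ∘ p) xs) ≡ length xs
    length-filterᵇ-split [] = refl
    length-filterᵇ-split (x ∷ xs) with p x
    ... | true  = cong suc (length-filterᵇ-split xs)
    ... | false = ≡.trans (+-suc _ _) (cong suc (length-filterᵇ-split xs))

    length-filterᵇ-∷ : ∀ x xs → length (filterᵇ p (x ∷ xs)) ≡ (if p x then 1 else 0) + length (filterᵇ p xs)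
    length-filterᵇ-∷ x xs with p x
    ... | true  = refl
    ... | false = refl

    length-filterᵇ-map : ∀ {B : Set} (f : B → A) xs → length (filterᵇ p (map f xs)) ≡ length (filterᵇ (p ∘ f) xs)
    length-filterᵇ-map f [] = refl
    length-filterᵇ-map f (x ∷ xs) with p (f x)
    ... | true  = cong suc (length-filterᵇ-map f xs)
    ... | false = length-filterᵇ-map f xs

module SignedPartitions where

  open import Data.Bool using (Bool; true; false; not; _∧_)
  open import Data.Empty using (⊥-elim)
  open import Data.Fin using (Fin; _↑ˡ_; _↑ʳ_; splitAt; join)
  import Data.Fin.Properties as Fin
  open import Data.List using (List; []; _∷_; map)
  open import Data.List.Relation.Unary.All using ([]; _∷_)
  open import Data.List.Relation.Unary.AllPairs using ([]; _∷_)
  open import Data.List.Relation.Unary.Any using (here; there)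
  open import Data.Nat using (ℕ; _+_)
  open import Data.Product using (_×_; _,_; proj₂)
  open import Data.Sum using (_⊎_; inj₁; inj₂)
  open import Data.Unit using (⊤; tt)
  open import Function using (_∘_)
  open import Level using (0ℓ)
  open import Relation.Binary.Bundles using (Setoid)
  open import Relation.Binary.PropositionalEquality using (_≡_; refl; sym; trans; cong; cong₂; subst; subst₂; setoid; module ≡-Reasoning)
  open import Defs
  open BoolFacts
  open Enumeration

  record IsNZPartition {X : Set} (ng : X → X) (R : X → X → Bool) : Set where
    field
      reflexive     : ∀ x → R x x ≡ true
      symmetric     : ∀ x y → R x y ≡ true → R y x ≡ true
      transitive    : ∀ x y z → R x y ≡ true → R y z ≡ true → R x z ≡ true
      neg-closed    : ∀ x y → R x y ≡ true → R (ng x) (ng y) ≡ true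
      no-zero-block : ∀ x → R x (ng x) ≡ false

  open IsNZPartition public

  IsNZPartition-pullback : ∀ {X Y : Set} {ngX : X → X} {ngY : Y → Y} {R : Y → Y → Bool} (φ : X → Y) →
    (∀ x → ngY (φ x) ≡ φ (ngX x)) → IsNZPartition ngY R → IsNZPartition ngX (λ x y → R (φ x) (φ y))
  IsNZPartition-pullback {R = R} φ φ-neg P = record
    { reflexive     = reflexive P ∘ φ
    ; symmetric     = λ x y → symmetric P (φ x) (φ y)
    ; transitive    = λ x y z → transitive P (φ x) (φ y) (φ z)
    ; neg-closed    = λ x y xy → subst₂ (λ u v → R u v ≡ true) (φ-neg x) (φ-neg y) (neg-closed P (φ x) (φ y) xy)
    ; no-zero-block = λ x → subst (λ w → R (φ x) w ≡ false) (φ-neg x) (no-zero-block P (φ x))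
    }

  IsNZPartition-resp : ∀ {X : Set} {ng : X → X} {R R' : X → X → Bool} → (∀ x y → R x y ≡ R' x y) →
    IsNZPartition ng R → IsNZPartition ng R'
  IsNZPartition-resp {ng = ng} R≡R' P = record
    { reflexive     = λ x → trans (sym (R≡R' x x)) (reflexive P x)
    ; symmetric     = λ x y xy → trans (sym (R≡R' y x)) (symmetric P x y (trans (R≡R' x y) xy))
    ; transitive    = λ x y z xy yz → trans (sym (R≡R' x z)) (transitive P x y z (trans (R≡R' x y) xy) (trans (R≡R' y z) yz))
    ; neg-closed    = λ x y xy → trans (sym (R≡R' (ng x) (ng y))) (neg-closed P x y (trans (R≡R' x y) xy))
    ; no-zero-block = λ x → trans (sym (R≡R' x (ng x))) (no-zero-block P x)
    }

  isBPartitionNZ : (n : ℕ) → Rel n → Bool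
  isBPartitionNZ n R = isBPartition n R ∧ noZeroBlock n R

  -- The zero-block clause of isBPartition holds vacuously when no x is related to -x.
  isBPartitionNZ⇒IsNZPartition : ∀ n R → isBPartitionNZ n R ≡ true → IsNZPartition (neg n) R
  isBPartitionNZ⇒IsNZPartition n R bp = record
    { reflexive     = allF-elim reflexive′
    ; symmetric     = λ x y → ⇒ᵇ-elim (allF-elim (allF-elim symmetric′ x) y)
    ; transitive    = λ x y z xy yz → ⇒ᵇ-elim (allF-elim (allF-elim (allF-elim transitive′ x) y) z) (∧-intro xy yz)
    ; neg-closed    = λ x y → ⇒ᵇ-elim (allF-elim (allF-elim negClosed′ x) y)
    ; no-zero-block = not-elim ∘ allF-elim (∧-elimʳ {isBPartition n R} bp)
    }
    where
    partition : isBPartition n R ≡ true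
    partition = ∧-elimˡ bp
    equivalence : isEquivalence n R ≡ true
    equivalence = ∧-elimˡ partition
    reflexive′ : allF (λ x → R x x) ≡ true
    reflexive′ = ∧-elimˡ equivalence
    symmetric′ : allF (λ x → allF (λ y → R x y ⇒ᵇ R y x)) ≡ true
    symmetric′ = ∧-elimˡ (∧-elimʳ {allF (λ x → R x x)} equivalence)
    transitive′ : allF (λ x → allF (λ y → allF (λ z → (R x y ∧ R y z) ⇒ᵇ R x z))) ≡ true
    transitive′ = ∧-elimʳ {allF (λ x → allF (λ y → R x y ⇒ᵇ R y x))} (∧-elimʳ {allF (λ x → R x x)} equivalence)
    negClosed′ : negClosed n R ≡ true
    negClosed′ = ∧-elimˡ (∧-elimʳ {isEquivalence n R} partition)

  IsNZPartition⇒isBPartitionNZ : ∀ n R → IsNZPartition (neg n) R → isBPartitionNZ n R ≡ true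
  IsNZPartition⇒isBPartitionNZ n R P =
    ∧-intro {isBPartition n R} (∧-intro {isEquivalence n R} (∧-intro {allF (λ x → R x x)} refl′ (∧-intro sym′ trans′)) (∧-intro neg′ atMostOne′)) noZero′
    where
    refl′ : allF (λ x → R x x) ≡ true
    refl′ = allF-intro (reflexive P)
    sym′ : allF (λ x → allF (λ y → R x y ⇒ᵇ R y x)) ≡ true
    sym′ = allF-intro λ x → allF-intro λ y → ⇒ᵇ-intro (symmetric P x y)
    trans′ : allF (λ x → allF (λ y → allF (λ z → (R x y ∧ R y z) ⇒ᵇ R x z))) ≡ true
    trans′ = allF-intro λ x → allF-intro λ y → allF-intro λ z → ⇒ᵇ-intro λ xyz → transitive P x y z (∧-elimˡ xyz) (∧-elimʳ xyz)
    neg′ : negClosed n R ≡ true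
    neg′ = allF-intro λ x → allF-intro λ y → ⇒ᵇ-intro (neg-closed P x y)
    atMostOne′ : atMostOneZeroBlock n R ≡ true
    atMostOne′ = allF-intro λ x → allF-intro λ y → ⇒ᵇ-intro {R x (neg n x) ∧ R y (neg n y)} λ xy → ⊥-elim (true≢false (∧-elimˡ xy) (no-zero-block P x))
    noZero′ : noZeroBlock n R ≡ true
    noZero′ = allF-intro (not-intro ∘ no-zero-block P)

  isBPartitionNZ-resp : ∀ n {R R'} → (∀ x y → R x y ≡ R' x y) → isBPartitionNZ n R ≡ isBPartitionNZ n R'
  isBPartitionNZ-resp n {R} {R'} R≗R' = bool-ext
    (IsNZPartition⇒isBPartitionNZ n R' ∘ IsNZPartition-resp R≗R' ∘ isBPartitionNZ⇒IsNZPartition n R)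
    (IsNZPartition⇒isBPartitionNZ n R ∘ IsNZPartition-resp (λ x y → sym (R≗R' x y)) ∘ isBPartitionNZ⇒IsNZPartition n R')

  -- A signed element of [±(c + m)]: a sign (true for +) and one of c "constrained" or m "free" indices.
  Signed : ℕ → ℕ → Set
  Signed c m = Bool × (Fin c ⊎ Fin m)

  negate : ∀ {c m} → Signed c m → Signed c m
  negate (s , a) = not s , a

  negate-involutive : ∀ {c m} (x : Signed c m) → negate (negate x) ≡ x
  negate-involutive (true  , a) = refl
  negate-involutive (false , a) = refl

  encode : ∀ {c m} → Signed c m → Elt (c + m)
  encode {c} {m} (true  , a) = join c m a ↑ˡ (c + m)
  encode {c} {m} (false , a) = (c + m) ↑ʳ join c m a

  decode : ∀ c m → Elt (c + m) → Signed c m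
  decode c m x with splitAt (c + m) x
  ... | inj₁ i = true  , splitAt c i
  ... | inj₂ i = false , splitAt c i

  decode-encode : ∀ {c m} (x : Signed c m) → decode c m (encode x) ≡ x
  decode-encode {c} {m} (true  , a) rewrite Fin.splitAt-↑ˡ (c + m) (join c m a) (c + m) | Fin.splitAt-join c m a = refl
  decode-encode {c} {m} (false , a) rewrite Fin.splitAt-↑ʳ (c + m) (c + m) (join c m a) | Fin.splitAt-join c m a = refl

  encode-decode : ∀ {c m} (x : Elt (c + m)) → encode {c} {m} (decode c m x) ≡ x
  encode-decode {c} {m} x with splitAt (c + m) x in eq
  ... | inj₁ i rewrite Fin.join-splitAt c m i = Fin.splitAt⁻¹-↑ˡ eq
  ... | inj₂ i rewrite Fin.join-splitAt c m i = Fin.splitAt⁻¹-↑ʳ eq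

  neg-encode : ∀ {c m} (x : Signed c m) → neg (c + m) (encode x) ≡ encode (negate x)
  neg-encode {c} {m} (true  , a) rewrite Fin.splitAt-↑ˡ (c + m) (join c m a) (c + m) = refl
  neg-encode {c} {m} (false , a) rewrite Fin.splitAt-↑ʳ (c + m) (c + m) (join c m a) = refl

  negate-decode : ∀ {c m} (x : Elt (c + m)) → negate (decode c m x) ≡ decode c m (neg (c + m) x)
  negate-decode {c} {m} x = begin
    negate (decode c m x)                          ≡⟨ decode-encode (negate (decode c m x)) ⟨
    decode c m (encode (negate (decode c m x)))    ≡⟨ cong (decode c m) (neg-encode (decode c m x)) ⟨
    decode c m (neg (c + m) (encode (decode c m x))) ≡⟨ cong (decode c m ∘ neg (c + m)) (encode-decode {c} {m} x) ⟩
    decode c m (neg (c + m) x)                     ∎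
    where open ≡-Reasoning

  SRel : ℕ → ℕ → Set
  SRel c m = Signed c m → Signed c m → Bool

  toSRel : ∀ {c m} → Rel (c + m) → SRel c m
  toSRel R x y = R (encode x) (encode y)

  fromSRel : ∀ {c m} → SRel c m → Rel (c + m)
  fromSRel {c} {m} S x y = S (decode c m x) (decode c m y)

  relSetoid : Set → Setoid 0ℓ 0ℓ
  relSetoid X = X →ₛ (X →ₛ setoid Bool)

  tupleSetoid : Set → ℕ → Setoid 0ℓ 0ℓ
  tupleSetoid X r = Fin r →ₛ relSetoid X

  allRels-enumerate : ∀ n → Enumerates (relSetoid (Elt n)) (λ _ → ⊤) (allRels n)
  allRels-enumerate n = Enumerates-⇔ (λ _ → tt) (λ _ _ → tt)
    (Enumerates-allFuns (n + n) (Enumerates-⇔ (λ _ → tt) (λ _ _ → tt) (Enumerates-allFuns (n + n) bools)))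
    where
    bools : Enumerates (setoid Bool) (λ _ → ⊤) (true ∷ false ∷ [])
    bools = record
      { sound    = tt ∷ tt ∷ []
      ; complete = λ { {true} _ → here refl ; {false} _ → there (here refl) }
      ; unique   = ((λ ()) ∷ []) ∷ [] ∷ []
      }

  BPartsNZ-enumerate : ∀ n → Enumerates (relSetoid (Elt n)) (IsNZPartition (neg n)) (BPartsNZ n)
  BPartsNZ-enumerate n = Enumerates-⇔ (isBPartitionNZ⇒IsNZPartition n _ ∘ proj₂) (λ P → tt , IsNZPartition⇒isBPartitionNZ n _ P)
    (Enumerates-filterᵇ (isBPartitionNZ n) (isBPartitionNZ-resp n) (allRels-enumerate n))

  signed-correspondence : ∀ c m → Correspondence (relSetoid (Elt (c + m))) (relSetoid (Signed c m))
    (IsNZPartition (neg (c + m))) (IsNZPartition negate)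
  signed-correspondence c m = record
    { to        = toSRel
    ; from      = fromSRel
    ; to-cong   = λ R≗R' x y → R≗R' (encode x) (encode y)
    ; from-cong = λ S≗S' x y → S≗S' (decode c m x) (decode c m y)
    ; to-P      = IsNZPartition-pullback encode neg-encode
    ; from-Q    = IsNZPartition-pullback (decode c m) (negate-decode {c} {m})
    ; from∘to   = λ {R} _ x y → cong₂ R (encode-decode {c} {m} x) (encode-decode {c} {m} y)
    ; to∘from   = λ {S} _ x y → cong₂ S (decode-encode x) (decode-encode y)
    }

  tuples : (r c m : ℕ) → List (Fin r → SRel c m)
  tuples r c m = allFuns r (map toSRel (BPartsNZ (c + m)))

  tuples-enumerate : ∀ r c m → Enumerates (tupleSetoid (Signed c m) r) (λ π → ∀ t → IsNZPartition negate (π t)) (tuples r c m)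
  tuples-enumerate r c m = Enumerates-allFuns r (Enumerates-map (signed-correspondence c m) (BPartsNZ-enumerate (c + m)))

module FinSearch where

  open import Data.Bool using (Bool; true; false; not; _∧_; if_then_else_)
  open import Data.Empty using (⊥-elim)
  open import Data.Fin using (Fin; _<_; _≟_)
  import Data.Fin as Fin
  import Data.Fin.Properties as Fin
  open import Data.Maybe using (Maybe; just; nothing)
  import Data.Maybe as Maybe
  open import Data.Nat using (ℕ; zero; suc; _+_; _≤_; z≤n; s≤s)
  open import Data.Nat.Properties using (≤-trans; n≤1+n; +-suc)
  open import Data.Product using (_×_; _,_)
  open import Function using (_∘_)
  open import Relation.Binary.PropositionalEquality using (_≡_; refl; sym; trans; cong; cong₂)
  open import Relation.Nullary.Decidable using (yes; no)
  open import Defs using (eqᵇ)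
  open BoolFacts

  eqᵇ-refl : ∀ {m} (i : Fin m) → eqᵇ i i ≡ true
  eqᵇ-refl i with i ≟ i
  ... | yes _   = refl
  ... | no i≢i = ⊥-elim (i≢i refl)

  eqᵇ⇒≡ : ∀ {m} {i j : Fin m} → eqᵇ i j ≡ true → i ≡ j
  eqᵇ⇒≡ {i = i} {j} _ with i ≟ j
  ... | yes i≡j = i≡j

  allBelow : ∀ {m} → Fin m → (Fin m → Bool) → Bool
  allBelow Fin.zero    p = true
  allBelow (Fin.suc i) p = p Fin.zero ∧ allBelow i (p ∘ Fin.suc)

  allBelow-elim : ∀ {m} (i : Fin m) {p : Fin m → Bool} → allBelow i p ≡ true → ∀ k → k < i → p k ≡ true
  allBelow-elim (Fin.suc i) all Fin.zero    _         = ∧-elimˡ all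
  allBelow-elim (Fin.suc i) {p} all (Fin.suc k) (s≤s k<i) = allBelow-elim i (∧-elimʳ {p Fin.zero} all) k k<i

  allBelow-mono : ∀ {m} (i : Fin m) {p q : Fin m → Bool} → (∀ k → p k ≡ true → q k ≡ true) → allBelow i p ≡ true → allBelow i q ≡ true
  allBelow-mono Fin.zero    p⇒q _   = refl
  allBelow-mono (Fin.suc i) {p} p⇒q all =
    ∧-intro (p⇒q Fin.zero (∧-elimˡ all)) (allBelow-mono i (p⇒q ∘ Fin.suc) (∧-elimʳ {p Fin.zero} all))

  allBelow-cong : ∀ {m} (i : Fin m) {p q : Fin m → Bool} → (∀ k → p k ≡ q k) → allBelow i p ≡ allBelow i q
  allBelow-cong Fin.zero    p≡q = refl
  allBelow-cong (Fin.suc i) p≡q = cong₂ _∧_ (p≡q Fin.zero) (allBelow-cong i (p≡q ∘ Fin.suc))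

  indicator : Bool → ℕ
  indicator b = if b then 1 else 0

  count : ∀ {m} → (Fin m → Bool) → ℕ
  count {zero}  p = 0
  count {suc m} p = indicator (p Fin.zero) + count (p ∘ Fin.suc)

  count-cong : ∀ {m} {p q : Fin m → Bool} → (∀ k → p k ≡ q k) → count p ≡ count q
  count-cong {zero}  p≡q = refl
  count-cong {suc m} p≡q = cong₂ _+_ (cong indicator (p≡q Fin.zero)) (count-cong (p≡q ∘ Fin.suc))

  count≤ : ∀ {m} (p : Fin m → Bool) → count p ≤ m
  count≤ {zero}  p = z≤n
  count≤ {suc m} p with p Fin.zero
  ... | true  = s≤s (count≤ (p ∘ Fin.suc))
  ... | false = ≤-trans (count≤ (p ∘ Fin.suc)) (n≤1+n m)

  count-remove : ∀ {m} (a b : Fin m → Bool) (y : Fin m) → b y ≡ true → a y ≡ false →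
    (∀ i → b i ≡ true → a i ≡ false → i ≡ y) → suc (count (λ i → a i ∧ b i)) ≡ count b
  count-remove a b Fin.zero by ay only-y rewrite by | ay = cong suc (count-cong ∧b≡b)
    where
    ∧b≡b : ∀ k → a (Fin.suc k) ∧ b (Fin.suc k) ≡ b (Fin.suc k)
    ∧b≡b k with b (Fin.suc k) in bk | a (Fin.suc k) in ak
    ... | true  | true  = refl
    ... | true  | false with () ← only-y (Fin.suc k) bk ak
    ... | false | true  = refl
    ... | false | false = refl
  count-remove a b (Fin.suc y) by ay only-y = trans (sym (+-suc (indicator (a Fin.zero ∧ b Fin.zero)) _))
    (cong₂ _+_ head≡ (count-remove (a ∘ Fin.suc) (b ∘ Fin.suc) y by ay (λ i bi ai → Fin.suc-injective (only-y (Fin.suc i) bi ai))))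
    where
    head≡ : indicator (a Fin.zero ∧ b Fin.zero) ≡ indicator (b Fin.zero)
    head≡ with b Fin.zero in b0 | a Fin.zero in a0
    ... | true  | true  = refl
    ... | true  | false with () ← only-y Fin.zero b0 a0
    ... | false | true  = refl
    ... | false | false = refl

  search : ∀ {m} → (Fin m → Bool) → Maybe (Fin m)
  search {zero}  p = nothing
  search {suc m} p = if p Fin.zero then just Fin.zero else Maybe.map Fin.suc (search (p ∘ Fin.suc))

  search-cong : ∀ {m} {p q : Fin m → Bool} → (∀ k → p k ≡ q k) → search p ≡ search q
  search-cong {zero}  p≡q = refl
  search-cong {suc m} p≡q = cong₂ (λ b r → if b then just Fin.zero else Maybe.map Fin.suc r) (p≡q Fin.zero) (search-cong (p≡q ∘ Fin.suc))

  search-just : ∀ {m} (p : Fin m → Bool) {i} → search p ≡ just i → p i ≡ true × allBelow i (not ∘ p) ≡ true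
  search-just {suc m} p {i} found with p Fin.zero in p0
  search-just {suc m} p {Fin.zero} refl | true = p0 , refl
  search-just {suc m} p {i} found | false with search (p ∘ Fin.suc) in found′
  search-just {suc m} p {Fin.suc i} refl | false | just i with search-just (p ∘ Fin.suc) found′
  ... | pi , below = pi , ∧-intro (cong not p0) below

  search-nothing : ∀ {m} (p : Fin m → Bool) → search p ≡ nothing → ∀ k → p k ≡ false
  search-nothing {suc m} p none k with p Fin.zero in p0
  search-nothing {suc m} p () k | true
  search-nothing {suc m} p none k | false with search (p ∘ Fin.suc) in none′
  search-nothing {suc m} p none Fin.zero    | false | nothing = p0
  search-nothing {suc m} p none (Fin.suc k) | false | nothing = search-nothing (p ∘ Fin.suc) none′ k

  search-first : ∀ {m} (p : Fin m → Bool) (i : Fin m) → p i ≡ true → allBelow i (not ∘ p) ≡ true → search p ≡ just i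
  search-first {suc m} p Fin.zero pi _ rewrite pi = refl
  search-first {suc m} p (Fin.suc i) pi below with p Fin.zero
  ... | true  = ⊥-elim (true≢false below refl)
  ... | false rewrite search-first (p ∘ Fin.suc) i pi below = refl

module Leaders where

  open import Data.Bool using (Bool; true; false; not; _∧_)
  open import Data.Empty using (⊥; ⊥-elim)
  open import Data.Fin using (Fin)
  import Data.Fin as Fin
  import Data.Fin.Properties as Fin
  open import Data.Nat using (ℕ; zero; suc)
  open import Data.Product using (_,_)
  open import Data.Sum using (inj₁; inj₂)
  open import Function using (case_of_)
  open import Relation.Binary.Definitions using (tri<; tri≈; tri>)
  open import Relation.Binary.PropositionalEquality using (_≡_; refl; sym; trans; cong; cong₂; subst)
  open import Defs using (allF; _⇒ᵇ_; eqᵇ)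
  open BoolFacts
  open SignedPartitions
  open FinSearch

  ⋀ : ∀ {X : Set} {r} → (Fin r → X → X → Bool) → X → X → Bool
  ⋀ π x y = allF (λ t → π t x y)

  ⋀-elim : ∀ {X : Set} {r} (π : Fin r → X → X → Bool) {x y} → ⋀ π x y ≡ true → ∀ t → π t x y ≡ true
  ⋀-elim π {x} {y} = allF-elim {p = λ t → π t x y}

  ⋀-cong : ∀ {X : Set} {r} {π π′ : Fin r → X → X → Bool} → (∀ t x y → π t x y ≡ π′ t x y) → ∀ x y → ⋀ π x y ≡ ⋀ π′ x y
  ⋀-cong π≗π′ x y = allF-cong (λ t → π≗π′ t x y)

  -- The meet of a nonempty tuple has no zero block because its first component has none.
  ⋀-IsNZPartition : ∀ {X : Set} {ng : X → X} {r} (π : Fin (suc r) → X → X → Bool) →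
    (∀ t → IsNZPartition ng (π t)) → IsNZPartition ng (⋀ π)
  ⋀-IsNZPartition {ng = ng} π P = record
    { reflexive     = λ x → allF-intro {p = λ t → π t x x} (λ t → reflexive (P t) x)
    ; symmetric     = λ x y xy → allF-intro {p = λ t → π t y x} (λ t → symmetric (P t) x y (⋀-elim π xy t))
    ; transitive    = λ x y z xy yz → allF-intro {p = λ t → π t x z} (λ t → transitive (P t) x y z (⋀-elim π xy t) (⋀-elim π yz t))
    ; neg-closed    = λ x y xy → allF-intro {p = λ t → π t (ng x) (ng y)} (λ t → neg-closed (P t) x y (⋀-elim π xy t))
    ; no-zero-block = λ x → cong (_∧ allF (λ t → π (Fin.suc t) x (ng x))) (no-zero-block (P Fin.zero) x)
    }

  negate-swap : ∀ {c m} {R : SRel c m} → IsNZPartition negate R → ∀ x y → R (negate x) y ≡ R x (negate y)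
  negate-swap {R = R} P x y = bool-ext
    (λ -xRy → subst (λ u → R u (negate y) ≡ true) (negate-involutive x) (neg-closed P (negate x) y -xRy))
    (λ xR-y → subst (λ w → R (negate x) w ≡ true) (negate-involutive y) (neg-closed P x (negate y) xR-y))

  free : ∀ {c m} → Bool → Fin m → Signed c m
  free s j = s , inj₂ j

  con : ∀ {c m} → Bool → Fin c → Signed c m
  con s i = s , inj₁ i

  apart : ∀ {c m} → SRel c m → Fin m → Fin m → Bool
  apart M j k = not (M (free true j) (free true k)) ∧ not (M (free true j) (free false k))

  -- A leader is the least free index of its pair of blocks {B, -B}; #leaders counts these pairs.
  isLeader : ∀ {c m} → SRel c m → Fin m → Bool
  isLeader M j = allBelow j (apart M j)

  #leaders : ∀ {c m} → SRel c m → ℕ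
  #leaders M = count (isLeader M)

  isLeader-cong : ∀ {c m} {M M′ : SRel c m} → (∀ x y → M x y ≡ M′ x y) → ∀ j → isLeader M j ≡ isLeader M′ j
  isLeader-cong M≗M′ j = allBelow-cong j (λ k → cong₂ _∧_ (cong not (M≗M′ (free true j) (free true k))) (cong not (M≗M′ (free true j) (free false k))))

  #leaders-cong : ∀ {c m} {M M′ : SRel c m} → (∀ x y → M x y ≡ M′ x y) → #leaders M ≡ #leaders M′
  #leaders-cong M≗M′ = count-cong (isLeader-cong M≗M′)

  leaders-unique : ∀ {c m} {R : SRel c m} → IsNZPartition negate R → ∀ {i y} s →
    isLeader R i ≡ true → isLeader R y ≡ true → R (free true i) (free s y) ≡ true → i ≡ y
  leaders-unique {R = R} P {i} {y} s i-leads y-leads iRy with Fin.<-cmp i y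
  ... | tri≈ _ i≡y _ = i≡y
  ... | tri< i<y _ _ = ⊥-elim (y-not-leader s iRy)
    where
    y-apart-i = allBelow-elim y y-leads i i<y
    y-not-leader : ∀ s → R (free true i) (free s y) ≡ true → ⊥
    y-not-leader true  iRy = not-true-absurd (∧-elimˡ y-apart-i) (symmetric P _ _ iRy)
    y-not-leader false iRy = not-true-absurd (∧-elimʳ {not (R (free true y) (free true i))} y-apart-i) (symmetric P _ _ (neg-closed P _ _ iRy))
  ... | tri> _ _ y<i = ⊥-elim (i-not-leader s iRy)
    where
    i-apart-y = allBelow-elim i i-leads y y<i
    i-not-leader : ∀ s → R (free true i) (free s y) ≡ true → ⊥
    i-not-leader true  iRy = not-true-absurd (∧-elimˡ i-apart-y) iRy
    i-not-leader false iRy = not-true-absurd (∧-elimʳ {not (R (free true i) (free true y))} i-apart-y) iRy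

  ConstrainedSingletons : ∀ {c m} → SRel c m → Set
  ConstrainedSingletons {c} M = ∀ (i : Fin c) w → M (con true i) w ≡ true → w ≡ con true i

  ConstrainedSingletons-cong : ∀ {c m} {M M′ : SRel c m} → (∀ x y → M x y ≡ M′ x y) → ConstrainedSingletons M → ConstrainedSingletons M′
  ConstrainedSingletons-cong M≗M′ singletons i w iM′w = singletons i w (trans (M≗M′ _ _) iM′w)

  ConstrainedSingletons-negate : ∀ {c m} {M : SRel c m} → IsNZPartition negate M → ConstrainedSingletons M →
    ∀ i w → M (con false i) w ≡ true → w ≡ con false i
  ConstrainedSingletons-negate P singletons i w -iMw =
    trans (sym (negate-involutive w)) (cong negate (singletons i (negate w) (neg-closed P (con false i) w -iMw)))

  private
    conApartCon : ∀ {c m} → SRel c m → Fin c → Fin c → Bool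
    conApartCon M i i′ = (M (con true i) (con true i′) ⇒ᵇ eqᵇ i i′) ∧ not (M (con true i) (con false i′))

    conApartFree : ∀ {c m} → SRel c m → Fin c → Fin m → Bool
    conApartFree M i j = not (M (con true i) (free true j)) ∧ not (M (con true i) (free false j))

    conIsolated : ∀ {c m} → SRel c m → Fin c → Bool
    conIsolated M i = allF (conApartCon M i) ∧ allF (conApartFree M i)

  constrainedSingletons : ∀ {c m} → SRel c m → Bool
  constrainedSingletons M = allF (conIsolated M)

  constrainedSingletons-cong : ∀ {c m} {M M′ : SRel c m} → (∀ x y → M x y ≡ M′ x y) → constrainedSingletons M ≡ constrainedSingletons M′
  constrainedSingletons-cong M≗M′ = allF-cong λ i →
    cong₂ _∧_ (allF-cong λ i′ → cong₂ _∧_ (cong₂ _⇒ᵇ_ (M≗M′ (con true i) (con true i′)) refl) (cong not (M≗M′ (con true i) (con false i′))))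
              (allF-cong λ j → cong₂ _∧_ (cong not (M≗M′ (con true i) (free true j))) (cong not (M≗M′ (con true i) (free false j))))

  constrainedSingletons-sound : ∀ {c m} (M : SRel c m) → constrainedSingletons M ≡ true → ConstrainedSingletons M
  constrainedSingletons-sound M all i (true  , inj₁ i′) iMw = cong (λ k → true , inj₁ k) (sym (eqᵇ⇒≡ (⇒ᵇ-elim (∧-elimˡ (apart-con i i′)) iMw)))
    where apart-con = λ i → allF-elim {p = conApartCon M i} (∧-elimˡ (allF-elim {p = conIsolated M} all i))
  constrainedSingletons-sound M all i (false , inj₁ i′) iMw = ⊥-elim (not-true-absurd (∧-elimʳ {M (con true i) (con true i′) ⇒ᵇ eqᵇ i i′} (apart-con i i′)) iMw)
    where apart-con = λ i → allF-elim {p = conApartCon M i} (∧-elimˡ (allF-elim {p = conIsolated M} all i))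
  constrainedSingletons-sound M all i (true  , inj₂ j)  iMw = ⊥-elim (not-true-absurd (∧-elimˡ (apart-free i j)) iMw)
    where apart-free = λ i → allF-elim {p = conApartFree M i} (∧-elimʳ {allF (conApartCon M i)} (allF-elim {p = conIsolated M} all i))
  constrainedSingletons-sound M all i (false , inj₂ j)  iMw = ⊥-elim (not-true-absurd (∧-elimʳ {not (M (con true i) (free true j))} (apart-free i j)) iMw)
    where apart-free = λ i → allF-elim {p = conApartFree M i} (∧-elimʳ {allF (conApartCon M i)} (allF-elim {p = conIsolated M} all i))

  constrainedSingletons-complete : ∀ {c m} (M : SRel c m) → ConstrainedSingletons M → constrainedSingletons M ≡ true
  constrainedSingletons-complete M singletons = allF-intro {p = conIsolated M} λ i → ∧-intro
    (allF-intro {p = conApartCon M i} λ i′ → ∧-intro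
      (⇒ᵇ-intro (λ iMi′ → case singletons i _ iMi′ of λ { refl → eqᵇ-refl i }))
      (¬true⇒not (λ iM-i′ → case singletons i _ iM-i′ of λ ())))
    (allF-intro {p = conApartFree M i} λ j → ∧-intro
      (¬true⇒not (λ iMj → case singletons i _ iMj of λ ()))
      (¬true⇒not (λ iM-j → case singletons i _ iM-j of λ ())))

-- The free index 0 is the new element: restriction removes it, extension adds it to the block of o, shifting makes it constrained.
module NewElement where

  open import Data.Bool using (Bool; true; false; not; _∨_)
  open import Data.Bool.Properties using (∨-zeroʳ; ∧-zeroʳ)
  open import Data.Empty using (⊥; ⊥-elim)
  open import Data.Fin using (Fin)
  import Data.Fin as Fin
  open import Data.Maybe using (just)
  open import Data.Nat using (zero; suc)
  open import Data.Product using (_×_; _,_)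
  open import Data.Sum using (_⊎_; inj₁; inj₂)
  import Data.Sum as Sum
  open import Function using (case_of_)
  open import Relation.Binary.PropositionalEquality using (_≡_; refl; sym; trans; cong; cong₂; subst)
  open import Defs using (allF)
  open BoolFacts
  open SignedPartitions
  open FinSearch
  open Leaders

  new : ∀ {c m} → Bool → Signed c (suc m)
  new s = s , inj₂ Fin.zero

  lift : ∀ {c m} → Signed c m → Signed c (suc m)
  lift (s , a) = s , Sum.map₂ Fin.suc a

  lift-injective : ∀ {c m} {x y : Signed c m} → lift x ≡ lift y → x ≡ y
  lift-injective {x = _ , inj₁ _} {_ , inj₁ _} refl = refl
  lift-injective {x = _ , inj₂ _} {_ , inj₂ _} refl = refl

  restrict : ∀ {c m} → SRel c (suc m) → SRel c m
  restrict R x y = R (lift x) (lift y)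

  view : ∀ {c m} → Signed c (suc m) → Bool ⊎ Signed c m
  view (s , inj₁ i)           = inj₂ (s , inj₁ i)
  view (s , inj₂ Fin.zero)    = inj₁ s
  view (s , inj₂ (Fin.suc j)) = inj₂ (s , inj₂ j)

  view-lift : ∀ {c m} (x : Signed c m) → view (lift x) ≡ inj₂ x
  view-lift (s , inj₁ i) = refl
  view-lift (s , inj₂ j) = refl

  Signed-elim : ∀ {c m} (Q : Signed c (suc m) → Set) → (∀ s → Q (new s)) → (∀ x → Q (lift x)) → ∀ x → Q x
  Signed-elim Q on-new on-lift (s , inj₁ i)           = on-lift (s , inj₁ i)
  Signed-elim Q on-new on-lift (s , inj₂ Fin.zero)    = on-new s
  Signed-elim Q on-new on-lift (s , inj₂ (Fin.suc j)) = on-lift (s , inj₂ j)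

  signed : ∀ {c m} → Bool → Signed c m → Signed c m
  signed true  o = o
  signed false o = negate o

  signed-not : ∀ {c m} s (o : Signed c m) → signed (not s) o ≡ negate (signed s o)
  signed-not true  o = refl
  signed-not false o = sym (negate-involutive o)

  sameSign : Bool → Bool → Bool
  sameSign true  b = b
  sameSign false b = not b

  sameSign⇒≡ : ∀ {s s′} → sameSign s s′ ≡ true → s ≡ s′
  sameSign⇒≡ {true}  {true}  _ = refl
  sameSign⇒≡ {false} {false} _ = refl

  -- extend o R puts ±new into the blocks of ±o.
  extendView : ∀ {c m} → Signed c m → SRel c m → Bool ⊎ Signed c m → Bool ⊎ Signed c m → Bool
  extendView o R (inj₁ s) (inj₁ s′) = sameSign s s′
  extendView o R (inj₁ s) (inj₂ y)  = R (signed s o) y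
  extendView o R (inj₂ x) (inj₁ s′) = R x (signed s′ o)
  extendView o R (inj₂ x) (inj₂ y)  = R x y

  extend : ∀ {c m} → Signed c m → SRel c m → SRel c (suc m)
  extend o R x y = extendView o R (view x) (view y)

  extendView-cong : ∀ {c m} (o : Signed c m) {R R′ : SRel c m} → (∀ a b → R a b ≡ R′ a b) →
    ∀ u w → extendView o R u w ≡ extendView o R′ u w
  extendView-cong o R≗R′ (inj₁ s) (inj₁ s′) = refl
  extendView-cong o R≗R′ (inj₁ s) (inj₂ y)  = R≗R′ _ _
  extendView-cong o R≗R′ (inj₂ x) (inj₁ s′) = R≗R′ _ _
  extendView-cong o R≗R′ (inj₂ x) (inj₂ y)  = R≗R′ _ _

  negateView : ∀ {c m} → Bool ⊎ Signed c m → Bool ⊎ Signed c m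
  negateView (inj₁ s) = inj₁ (not s)
  negateView (inj₂ x) = inj₂ (negate x)

  view-negate : ∀ {c m} (x : Signed c (suc m)) → negateView (view x) ≡ view (negate x)
  view-negate (s , inj₁ i)           = refl
  view-negate (s , inj₂ Fin.zero)    = refl
  view-negate (s , inj₂ (Fin.suc j)) = refl

  IsNZPartition-extendView : ∀ {c m} (o : Signed c m) {R : SRel c m} → IsNZPartition negate R →
    IsNZPartition negateView (extendView o R)
  IsNZPartition-extendView o {R} P = record
    { reflexive = reflexive′ ; symmetric = symmetric′ ; transitive = transitive′ ; neg-closed = neg-closed′ ; no-zero-block = no-zero-block′ }
    where
    reflexive′ : ∀ u → extendView o R u u ≡ true
    reflexive′ (inj₁ true)  = refl
    reflexive′ (inj₁ false) = refl
    reflexive′ (inj₂ x)     = reflexive P x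
    symmetric′ : ∀ u w → extendView o R u w ≡ true → extendView o R w u ≡ true
    symmetric′ (inj₁ true)  (inj₁ true)  _  = refl
    symmetric′ (inj₁ false) (inj₁ false) _  = refl
    symmetric′ (inj₁ s)     (inj₂ y)     uw = symmetric P _ _ uw
    symmetric′ (inj₂ x)     (inj₁ s)     uw = symmetric P _ _ uw
    symmetric′ (inj₂ x)     (inj₂ y)     uw = symmetric P _ _ uw
    same-sign : ∀ s s′ y → R (signed s o) y ≡ true → R y (signed s′ o) ≡ true → sameSign s s′ ≡ true
    same-sign true  true  _ _ _ = refl
    same-sign false false _ _ _ = refl
    same-sign true  false y oy y-o = ⊥-elim (true≢false (transitive P _ _ _ oy y-o) (no-zero-block P o))
    same-sign false true  y -oy yo = ⊥-elim (true≢false (transitive P _ _ _ -oy yo)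
      (subst (λ w → R (negate o) w ≡ false) (negate-involutive o) (no-zero-block P (negate o))))
    transitive′ : ∀ u w t → extendView o R u w ≡ true → extendView o R w t ≡ true → extendView o R u t ≡ true
    transitive′ (inj₁ s) (inj₁ s′) (inj₁ _) uw wt with sameSign⇒≡ {s} uw | sameSign⇒≡ {s′} wt
    ... | refl | refl = reflexive′ (inj₁ s)
    transitive′ (inj₁ s) (inj₁ _)  (inj₂ _) uw wt with sameSign⇒≡ {s} uw
    ... | refl = wt
    transitive′ (inj₁ s) (inj₂ y)  (inj₁ s′) uw wt = same-sign s s′ y uw wt
    transitive′ (inj₁ _) (inj₂ _)  (inj₂ _) uw wt = transitive P _ _ _ uw wt
    transitive′ (inj₂ _) (inj₁ s)  (inj₁ _) uw wt with sameSign⇒≡ {s} wt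
    ... | refl = uw
    transitive′ (inj₂ _) (inj₁ _)  (inj₂ _) uw wt = transitive P _ _ _ uw wt
    transitive′ (inj₂ _) (inj₂ _)  (inj₁ _) uw wt = transitive P _ _ _ uw wt
    transitive′ (inj₂ _) (inj₂ _)  (inj₂ _) uw wt = transitive P _ _ _ uw wt
    neg-closed′ : ∀ u w → extendView o R u w ≡ true → extendView o R (negateView u) (negateView w) ≡ true
    neg-closed′ (inj₁ true)  (inj₁ true)  _  = refl
    neg-closed′ (inj₁ false) (inj₁ false) _  = refl
    neg-closed′ (inj₁ s)     (inj₂ y)     uw rewrite signed-not s o = neg-closed P _ _ uw
    neg-closed′ (inj₂ x)     (inj₁ s)     uw rewrite signed-not s o = neg-closed P _ _ uw
    neg-closed′ (inj₂ x)     (inj₂ y)     uw = neg-closed P _ _ uw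
    no-zero-block′ : ∀ u → extendView o R u (negateView u) ≡ false
    no-zero-block′ (inj₁ true)  = refl
    no-zero-block′ (inj₁ false) = refl
    no-zero-block′ (inj₂ x)     = no-zero-block P x

  IsNZPartition-extend : ∀ {c m} (o : Signed c m) {R : SRel c m} → IsNZPartition negate R → IsNZPartition negate (extend o R)
  IsNZPartition-extend o P = IsNZPartition-pullback view view-negate (IsNZPartition-extendView o P)

  IsNZPartition-restrict : ∀ {c m} {R : SRel c (suc m)} → IsNZPartition negate R → IsNZPartition negate (restrict R)
  IsNZPartition-restrict = IsNZPartition-pullback lift (λ _ → refl)

  ⋀-extend : ∀ {c m r} (o : Signed c m) (σ : Fin (suc r) → SRel c m) → ∀ x y → ⋀ (λ t → extend o (σ t)) x y ≡ extend o (⋀ σ) x y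
  ⋀-extend {r = r} o σ x y = on-views (view x) (view y)
    where
    allF-const : ∀ {r} (b : Bool) → allF {suc r} (λ _ → b) ≡ b
    allF-const {zero}  true  = refl
    allF-const {zero}  false = refl
    allF-const {suc r} true  = allF-const {r} true
    allF-const {suc r} false = refl
    on-views : ∀ u w → allF (λ t → extendView o (σ t) u w) ≡ extendView o (⋀ σ) u w
    on-views (inj₁ s) (inj₁ s′) = allF-const {r} (sameSign s s′)
    on-views (inj₁ _) (inj₂ _)  = refl
    on-views (inj₂ _) (inj₁ _)  = refl
    on-views (inj₂ _) (inj₂ _)  = refl

  restrict-extend : ∀ {c m} (o : Signed c m) (R : SRel c m) → ∀ x y → restrict (extend o R) x y ≡ R x y
  restrict-extend o R x y rewrite view-lift x | view-lift y = refl

  new-new : ∀ {c m} {M : SRel c (suc m)} → IsNZPartition negate M → ∀ a b → M (new a) (new b) ≡ sameSign a b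
  new-new P true  true  = reflexive P _
  new-new P true  false = no-zero-block P _
  new-new P false true  = no-zero-block P _
  new-new P false false = reflexive P _

  extend-restrict : ∀ {c m} {M : SRel c (suc m)} → IsNZPartition negate M → (o : Signed c m) → M (new true) (lift o) ≡ true →
    ∀ x y → extend o (restrict M) x y ≡ M x y
  extend-restrict {M = M} P o newMo = Signed-elim (λ x → ∀ y → extend o (restrict M) x y ≡ M x y) from-new from-lift
    where
    newM±o : ∀ a → M (new a) (lift (signed a o)) ≡ true
    newM±o true  = newMo
    newM±o false = neg-closed P _ _ newMo
    from-new : ∀ a y → extend o (restrict M) (new a) y ≡ M (new a) y
    from-new a = Signed-elim (λ y → extend o (restrict M) (new a) y ≡ M (new a) y) (λ b → sym (new-new P a b))
      (λ y → trans (cong (extendView o (restrict M) (inj₁ a)) (view-lift y))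
         (bool-ext (transitive P _ _ _ (newM±o a)) (transitive P _ _ _ (symmetric P _ _ (newM±o a)))))
    from-lift : ∀ x y → extend o (restrict M) (lift x) y ≡ M (lift x) y
    from-lift x = Signed-elim (λ y → extend o (restrict M) (lift x) y ≡ M (lift x) y)
      (λ b → trans (cong (λ u → extendView o (restrict M) u (inj₁ b)) (view-lift x))
         (bool-ext (λ xR±o → transitive P _ _ _ xR±o (symmetric P _ _ (newM±o b))) (λ xMnew → transitive P _ _ _ xMnew (newM±o b))))
      (λ y → cong₂ (extendView o (restrict M)) (view-lift x) (view-lift y))

  joinsNew : ∀ {c m} → SRel c (suc m) → Fin m → Bool
  joinsNew M i = M (new true) (free true (Fin.suc i)) ∨ M (new true) (free false (Fin.suc i))

  newIsolated : ∀ {c m} → SRel c (suc m) → Bool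
  newIsolated M = allF (not ∘ joinsNew M)
    where open import Function using (_∘_)

  signTowardNew : ∀ {c m} → SRel c (suc m) → Fin m → Bool
  signTowardNew M i = M (new true) (free true (Fin.suc i))

  joinsNew-cong : ∀ {c m} {M M′ : SRel c (suc m)} → (∀ x y → M x y ≡ M′ x y) → ∀ i → joinsNew M i ≡ joinsNew M′ i
  joinsNew-cong M≗M′ i = cong₂ _∨_ (M≗M′ _ _) (M≗M′ _ _)

  newIsolated-cong : ∀ {c m} {M M′ : SRel c (suc m)} → (∀ x y → M x y ≡ M′ x y) → newIsolated M ≡ newIsolated M′
  newIsolated-cong M≗M′ = allF-cong (λ i → cong not (joinsNew-cong M≗M′ i))

  joinsNew-intro : ∀ {c m} {M : SRel c (suc m)} {s i} → M (new true) (free s (Fin.suc i)) ≡ true → joinsNew M i ≡ true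
  joinsNew-intro {s = true}  newMi rewrite newMi = refl
  joinsNew-intro {s = false} newMi rewrite newMi = ∨-zeroʳ _

  joinsNew-sign : ∀ {c m} (M : SRel c (suc m)) i → joinsNew M i ≡ true → M (new true) (free (signTowardNew M i) (Fin.suc i)) ≡ true
  joinsNew-sign M i joins with M (new true) (free true (Fin.suc i)) in newMi
  ... | true  = newMi
  ... | false = joins

  joinsNew-propagate : ∀ {c m} {M : SRel c (suc m)} → IsNZPartition negate M → ∀ s {i k s′} → M (new true) (free s (Fin.suc i)) ≡ true →
    M (free true (Fin.suc i)) (free s′ (Fin.suc k)) ≡ true → joinsNew M k ≡ true
  joinsNew-propagate {M = M} P true  {s′ = s′} newMi iMk = joinsNew-intro {M = M} {s′} (transitive P _ _ _ newMi iMk)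
  joinsNew-propagate {M = M} P false {s′ = s′} newM-i iMk = joinsNew-intro {M = M} {not s′} (transitive P _ _ _ newM-i (neg-closed P _ _ iMk))

  firstJoiner-isLeader : ∀ {c m} {M : SRel c (suc m)} → IsNZPartition negate M → ∀ {i} → search (joinsNew M) ≡ just i →
    isLeader (restrict M) i ≡ true
  firstJoiner-isLeader {M = M} P {i} found with search-just (joinsNew M) found
  ... | i-joins , none-below = allBelow-mono i apart-from-i none-below
    where
    newM±i = joinsNew-sign M i i-joins
    apart-from-i : ∀ k → not (joinsNew M k) ≡ true → apart (restrict M) i k ≡ true
    apart-from-i k k-apart = ∧-intro
      (¬true⇒not (not-true-absurd k-apart ∘′ joinsNew-propagate P (signTowardNew M i) newM±i))
      (¬true⇒not (not-true-absurd k-apart ∘′ joinsNew-propagate P (signTowardNew M i) newM±i))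
      where open import Function using (_∘′_)

  #leaders-restrict : ∀ {c m} {M : SRel c (suc m)} → IsNZPartition negate M → ∀ s y → M (new true) (free s (Fin.suc y)) ≡ true →
    isLeader (restrict M) y ≡ true → #leaders M ≡ #leaders (restrict M)
  #leaders-restrict {c} {m} {M} P s y newMy y-leads = count-remove apartFromNew (isLeader (restrict M)) y y-leads (y-joins s newMy) only-y
    where
    apartFromNew : Fin m → Bool
    apartFromNew i = apart M (Fin.suc i) Fin.zero
    P′ = IsNZPartition-restrict P
    y-joins : ∀ s → M (new true) (free s (Fin.suc y)) ≡ true → apartFromNew y ≡ false
    y-joins true  newMy rewrite symmetric P _ _ newMy = refl
    y-joins false newMy rewrite symmetric P _ _ (neg-closed P _ _ newMy) = ∧-zeroʳ _
    only-y : ∀ i → isLeader (restrict M) i ≡ true → apartFromNew i ≡ false → i ≡ y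
    only-y i i-leads joins with M (free true (Fin.suc i)) (new true) in iMnew | M (free true (Fin.suc i)) (new false) in iM-new
    ... | true  | _     = leaders-unique P′ s i-leads y-leads (transitive P _ _ _ iMnew newMy)
    ... | false | true  = leaders-unique P′ (not s) i-leads y-leads (transitive P _ _ _ iM-new (neg-closed P _ _ newMy))
    ... | false | false = ⊥-elim (true≢false refl joins)

  module _ {c m} {R : SRel c m} (P : IsNZPartition negate R) (s : Bool) (y : Fin m) (y-leads : isLeader R y ≡ true) where

    private
      o : Signed c m
      o = free s y
      M : SRel c (suc m)
      M = extend o R

    new-joins-o : M (new true) (free s (Fin.suc y)) ≡ true
    new-joins-o = reflexive P o

    #leaders-extend : #leaders M ≡ #leaders R
    #leaders-extend = trans (#leaders-restrict (IsNZPartition-extend o P) s y new-joins-o (trans (isLeader-cong (restrict-extend o R) y) y-leads))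
      (#leaders-cong (restrict-extend o R))

    ConstrainedSingletons-extend : ConstrainedSingletons R → ConstrainedSingletons M
    ConstrainedSingletons-extend singletons i = Signed-elim (λ w → M (con true i) w ≡ true → w ≡ con true i)
      (λ s′ iMnew → ⊥-elim (o-free s′ (singletons i _ iMnew)))
      (λ x iMx → cong lift (singletons i x (subst (λ u → extendView o R (inj₂ (con true i)) u ≡ true) (view-lift x) iMx)))
      where
      o-free : ∀ s′ → signed s′ o ≡ con true i → ⊥
      o-free true  ()
      o-free false ()

    newIsolated-extend : newIsolated M ≡ false
    newIsolated-extend with newIsolated M in isolated
    ... | true  = ⊥-elim (not-true-absurd (allF-elim isolated y) (joinsNew-intro {M = M} {s} {y} new-joins-o))
    ... | false = refl

    search-extend : search (joinsNew M) ≡ just y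
    search-extend = search-first (joinsNew M) y (joinsNew-intro {M = M} {s} {y} new-joins-o) (allBelow-mono y apart⇒not-joins y-leads)
      where
      apart⇒not-joins : ∀ k → apart R y k ≡ true → not (joinsNew M k) ≡ true
      apart⇒not-joins k = by-sign s
        where
        by-sign : ∀ s → apart R y k ≡ true → not (R (free s y) (free true k) ∨ R (free s y) (free false k)) ≡ true
        by-sign true  y-apart
          rewrite not-elim (∧-elimˡ {not (R (free true y) (free true k))} y-apart) | not-elim (∧-elimʳ {not (R (free true y) (free true k))} y-apart) = refl
        by-sign false y-apart
          rewrite negate-swap P (free true y) (free true k) | negate-swap P (free true y) (free false k)
                | not-elim (∧-elimˡ {not (R (free true y) (free true k))} y-apart) | not-elim (∧-elimʳ {not (R (free true y) (free true k))} y-apart) = refl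

    signTowardNew-extend : signTowardNew M y ≡ s
    signTowardNew-extend = by-sign s
      where
      by-sign : ∀ s → R (free s y) (free true y) ≡ s
      by-sign true  = reflexive P (free true y)
      by-sign false = no-zero-block P (free false y)

  ConstrainedSingletons-restrict : ∀ {c m} {M : SRel c (suc m)} → ConstrainedSingletons M → ConstrainedSingletons (restrict M)
  ConstrainedSingletons-restrict singletons i w iMw = lift-injective (singletons i (lift w) iMw)

  shift : ∀ {c m} → Signed (suc c) m → Signed c (suc m)
  shift (s , inj₁ Fin.zero)    = s , inj₂ Fin.zero
  shift (s , inj₁ (Fin.suc i)) = s , inj₁ i
  shift (s , inj₂ j)           = s , inj₂ (Fin.suc j)

  unshift : ∀ {c m} → Signed c (suc m) → Signed (suc c) m
  unshift (s , inj₁ i)           = s , inj₁ (Fin.suc i)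
  unshift (s , inj₂ Fin.zero)    = s , inj₁ Fin.zero
  unshift (s , inj₂ (Fin.suc j)) = s , inj₂ j

  shift-unshift : ∀ {c m} (x : Signed c (suc m)) → shift (unshift x) ≡ x
  shift-unshift (s , inj₁ i)           = refl
  shift-unshift (s , inj₂ Fin.zero)    = refl
  shift-unshift (s , inj₂ (Fin.suc j)) = refl

  unshift-shift : ∀ {c m} (x : Signed (suc c) m) → unshift (shift x) ≡ x
  unshift-shift (s , inj₁ Fin.zero)    = refl
  unshift-shift (s , inj₁ (Fin.suc i)) = refl
  unshift-shift (s , inj₂ j)           = refl

  negate-shift : ∀ {c m} (x : Signed (suc c) m) → negate (shift x) ≡ shift (negate x)
  negate-shift (s , inj₁ Fin.zero)    = refl
  negate-shift (s , inj₁ (Fin.suc i)) = refl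
  negate-shift (s , inj₂ j)           = refl

  negate-unshift : ∀ {c m} (x : Signed c (suc m)) → negate (unshift x) ≡ unshift (negate x)
  negate-unshift (s , inj₁ i)           = refl
  negate-unshift (s , inj₂ Fin.zero)    = refl
  negate-unshift (s , inj₂ (Fin.suc j)) = refl

  shiftRel : ∀ {c m} → SRel c (suc m) → SRel (suc c) m
  shiftRel M x y = M (shift x) (shift y)

  unshiftRel : ∀ {c m} → SRel (suc c) m → SRel c (suc m)
  unshiftRel M x y = M (unshift x) (unshift y)

  module _ {c m} {M : SRel c (suc m)} (P : IsNZPartition negate M) (singletons : ConstrainedSingletons M) (isolated : newIsolated M ≡ true) where

    new-singleton : ∀ w → M (new true) w ≡ true → w ≡ new true
    new-singleton = Signed-elim _ from-new from-lift
      where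
      from-new : ∀ s → M (new true) (new s) ≡ true → new s ≡ new true
      from-new true  _       = refl
      from-new false newM-new = ⊥-elim (true≢false newM-new (no-zero-block P (new true)))
      from-lift : ∀ x → M (new true) (lift x) ≡ true → lift x ≡ new true
      from-lift (true  , inj₁ i) newMi = case singletons i (new true) (symmetric P _ _ newMi) of λ ()
      from-lift (false , inj₁ i) newMi = case ConstrainedSingletons-negate P singletons i (new true) (symmetric P _ _ newMi) of λ ()
      from-lift (s     , inj₂ j) newMj = ⊥-elim (not-true-absurd (allF-elim isolated j) (joinsNew-intro {M = M} {s} {j} newMj))

    ConstrainedSingletons-shift : ConstrainedSingletons (shiftRel M)
    ConstrainedSingletons-shift Fin.zero    w iMw = trans (sym (unshift-shift w)) (cong unshift (new-singleton (shift w) iMw))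
    ConstrainedSingletons-shift (Fin.suc i) w iMw = trans (sym (unshift-shift w)) (cong unshift (singletons i (shift w) iMw))

    -- new is a leader of M; the other leaders of M are those of shiftRel M.
    #leaders-shift : #leaders M ≡ suc (#leaders (shiftRel M))
    #leaders-shift = cong suc (count-cong same-leaders)
      where
      same-leaders : ∀ i → isLeader M (Fin.suc i) ≡ isLeader (shiftRel M) i
      same-leaders i with M (free true (Fin.suc i)) (new true) in iMnew | M (free true (Fin.suc i)) (new false) in iM-new
      ... | true  | _     = case new-singleton _ (symmetric P _ _ iMnew) of λ ()
      ... | false | true  = case new-singleton _ (symmetric P _ _ (neg-closed P _ _ iM-new)) of λ ()
      ... | false | false = refl

  ConstrainedSingletons-unshift : ∀ {c m} {M : SRel c (suc m)} → ConstrainedSingletons (shiftRel M) →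
    ConstrainedSingletons M × newIsolated M ≡ true
  ConstrainedSingletons-unshift {M = M} singletons = singletons′ , allF-intro (λ j → ¬true⇒not (λ joins → isolated j (joinsNew-sign M j joins)))
    where
    singletons′ : ConstrainedSingletons M
    singletons′ i w iMw = trans (sym (shift-unshift w)) (cong shift (singletons (Fin.suc i) (unshift w) (subst (λ u → M (con true i) u ≡ true) (sym (shift-unshift w)) iMw)))
    isolated : ∀ j {s} → M (new true) (free s (Fin.suc j)) ≡ true → ⊥
    isolated j {s} newMj = case singletons Fin.zero (free s j) newMj of λ ()

module StirlingB where

  open import Data.Nat using (ℕ; zero; suc; _+_; _*_)

  -- stirling₂ᴮ n j counts the B_n-partitions without zero block having j pairs of blocks {B, -B}:
  -- element n either opens a new pair or joins one of the 2j blocks of a partition of [±(n-1)].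
  stirling₂ᴮ : ℕ → ℕ → ℕ
  stirling₂ᴮ zero    zero    = 1
  stirling₂ᴮ zero    (suc j) = 0
  stirling₂ᴮ (suc m) zero    = 0
  stirling₂ᴮ (suc m) (suc j) = stirling₂ᴮ m j + (suc j + suc j) * stirling₂ᴮ m (suc j)

module Counting (r′ : Data.Nat.ℕ) where

  open import Data.Bool using (Bool; true; false; not; _∧_)
  open import Data.Bool.Properties using (∧-zeroʳ; T-≡)
  open import Data.Empty using (⊥-elim)
  open import Data.Fin using (Fin)
  import Data.Fin as Fin
  open import Data.List using (List; []; _∷_; map; filterᵇ; length)
  open import Data.List.Properties using (length-map)
  open import Data.List.Relation.Unary.All as All using (All; []; _∷_)
  open import Data.List.Relation.Unary.AllPairs using ([]; _∷_)
  import Data.List.Relation.Unary.Unique.Setoid as Unique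
  import Data.List.Relation.Unary.Unique.Setoid.Properties as Unique
  open import Data.List.Relation.Unary.Any using (here; there)
  import Data.List.Relation.Unary.Any as Any
  import Data.List.Relation.Unary.Any.Properties as Any
  import Data.List.Relation.Unary.All.Properties as All
  open import Data.Maybe using (just; nothing)
  open import Data.Nat using (ℕ; zero; suc; _+_; _*_; _^_; _<_; _≡ᵇ_; s≤s)
  open import Data.Nat.Tactic.RingSolver using (solve-∀)
  open import Data.Nat.Properties using (suc-injective; +-suc; *-zeroʳ; +-identityʳ; *-distribʳ-+; *-assoc; *-identityˡ; ≡ᵇ⇒≡; ≡⇒≡ᵇ)
  open import Data.Product using (Σ; _×_; _,_; proj₁; proj₂; map₂)
  open import Data.Product.Relation.Binary.Pointwise.NonDependent using (_×ₛ_)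
  open import Data.Sum using (inj₁)
  open import Data.Unit using (⊤; tt)
  open import Function using (_∘_; Equivalence)
  open import Relation.Binary.Bundles using (Setoid)
  open import Relation.Binary.PropositionalEquality using (_≡_; _≢_; refl; sym; trans; cong; cong₂; subst; setoid; module ≡-Reasoning)
  open import Defs using (allF; Elt; neg; N; ND; BPartsNZ; allFuns; meet; minimallyIntersecting; _⇒ᵇ_; eqᵇ)
  open BoolFacts
  open Enumeration
  open SignedPartitions
  open FinSearch
  open Leaders
  open NewElement
  open StirlingB
  module ∑ℕ = FiniteSum Data.Nat.Properties.+-*-commutativeSemiring
  open ∑ℕ using (∑)

  r : ℕ
  r = suc r′

  Tuple : ℕ → ℕ → Set
  Tuple c m = Fin r → SRel c m

  _≈ᵗ_ : ∀ {c m} → Tuple c m → Tuple c m → Set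
  π ≈ᵗ π′ = ∀ t x y → π t x y ≡ π′ t x y

  AllNZ : ∀ {c m} → Tuple c m → Set
  AllNZ π = ∀ t → IsNZPartition negate (π t)

  hasShape : ∀ {c m} → ℕ → SRel c m → Bool
  hasShape j M = constrainedSingletons M ∧ (#leaders M ≡ᵇ j)

  Shaped : ∀ c m → ℕ → Tuple c m → Set
  Shaped c m j π = AllNZ π × hasShape j (⋀ π) ≡ true

  shapedTuples : ∀ c m → ℕ → List (Tuple c m)
  shapedTuples c m j = filterᵇ (hasShape j ∘ ⋀) (tuples r c m)

  #shaped : ℕ → ℕ → ℕ → ℕ
  #shaped c m j = length (shapedTuples c m j)

  hasShape-cong : ∀ {c m} j {M M′ : SRel c m} → (∀ x y → M x y ≡ M′ x y) → hasShape j M ≡ hasShape j M′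
  hasShape-cong j M≗M′ = cong₂ _∧_ (constrainedSingletons-cong M≗M′) (cong (_≡ᵇ j) (#leaders-cong M≗M′))

  shapedTuples-enumerate : ∀ c m j → Enumerates (tupleSetoid (Signed c m) r) (Shaped c m j) (shapedTuples c m j)
  shapedTuples-enumerate c m j = Enumerates-filterᵇ (hasShape j ∘ ⋀) (hasShape-cong j ∘ ⋀-cong) (tuples-enumerate r c m)

  hasShape-singletons : ∀ {c m} j (M : SRel c m) → hasShape j M ≡ true → ConstrainedSingletons M
  hasShape-singletons j M shape = constrainedSingletons-sound M (∧-elimˡ shape)

  hasShape-#leaders : ∀ {c m} j (M : SRel c m) → hasShape j M ≡ true → #leaders M ≡ j
  hasShape-#leaders j M shape = ≡ᵇ⇒≡ (#leaders M) j (Equivalence.from T-≡ (∧-elimʳ {constrainedSingletons M} shape))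

  hasShape-intro : ∀ {c m} j (M : SRel c m) → ConstrainedSingletons M → #leaders M ≡ j → hasShape j M ≡ true
  hasShape-intro j M singletons refl = ∧-intro (constrainedSingletons-complete M singletons) (Equivalence.to T-≡ (≡⇒≡ᵇ (#leaders M) (#leaders M) refl))

  #shaped-0-suc : ∀ c j → #shaped c 0 (suc j) ≡ 0
  #shaped-0-suc c j = filterᵇ-none (hasShape (suc j) ∘ ⋀) (All.universal (λ (π : Tuple c 0) → ∧-zeroʳ (constrainedSingletons (⋀ π))) (tuples r c 0))

  #shaped-suc-0 : ∀ c m → #shaped c (suc m) 0 ≡ 0
  #shaped-suc-0 c m = filterᵇ-none (hasShape 0 ∘ ⋀) (All.universal (λ (π : Tuple c (suc m)) → ∧-zeroʳ (constrainedSingletons (⋀ π))) (tuples r c (suc m)))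

  newIsolatedᵗ : ∀ {c m} → Tuple c (suc m) → Bool
  newIsolatedᵗ = newIsolated ∘ ⋀

  isolatedTuples : ∀ c m j → List (Tuple c (suc m))
  isolatedTuples c m j = filterᵇ newIsolatedᵗ (shapedTuples c (suc m) (suc j))

  joinedTuples : ∀ c m j → List (Tuple c (suc m))
  joinedTuples c m j = filterᵇ (not ∘ newIsolatedᵗ) (shapedTuples c (suc m) (suc j))

  #shaped-split : ∀ c m j → #shaped c (suc m) (suc j) ≡ length (isolatedTuples c m j) + length (joinedTuples c m j)
  #shaped-split c m j = sym (length-filterᵇ-split newIsolatedᵗ (shapedTuples c (suc m) (suc j)))

  -- Isolating the new element makes it a constrained one; it was a leader, so one leader is lost.
  shift-correspondence : ∀ c m j → Correspondence (tupleSetoid (Signed c (suc m)) r) (tupleSetoid (Signed (suc c) m) r)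
    (λ π → Shaped c (suc m) (suc j) π × newIsolatedᵗ π ≡ true) (Shaped (suc c) m j)
  shift-correspondence c m j = record
    { to        = λ π t → shiftRel (π t)
    ; from      = λ ρ t → unshiftRel (ρ t)
    ; to-cong   = λ π≈π′ t x y → π≈π′ t (shift x) (shift y)
    ; from-cong = λ ρ≈ρ′ t x y → ρ≈ρ′ t (unshift x) (unshift y)
    ; to-P      = to-P
    ; from-Q    = from-Q
    ; from∘to   = λ {π} _ t x y → cong₂ (π t) (shift-unshift x) (shift-unshift y)
    ; to∘from   = λ {ρ} _ t x y → cong₂ (ρ t) (unshift-shift x) (unshift-shift y)
    }
    where
    to-P : ∀ {π} → Shaped c (suc m) (suc j) π × newIsolatedᵗ π ≡ true → Shaped (suc c) m j (λ t → shiftRel (π t))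
    to-P {π} ((nz , shape) , isolated) =
      (λ t → IsNZPartition-pullback shift negate-shift (nz t)) ,
      hasShape-intro j (shiftRel M) (ConstrainedSingletons-shift P singletons isolated)
        (suc-injective (trans (sym (#leaders-shift P singletons isolated)) (hasShape-#leaders (suc j) M shape)))
      where
      M = ⋀ π
      P = ⋀-IsNZPartition π nz
      singletons = hasShape-singletons (suc j) M shape
    from-Q : ∀ {ρ} → Shaped (suc c) m j ρ → Shaped c (suc m) (suc j) (λ t → unshiftRel (ρ t)) × newIsolatedᵗ (λ t → unshiftRel (ρ t)) ≡ true
    from-Q {ρ} (nz , shape) =
      (nz′ , hasShape-intro (suc j) M singletons
        (trans (#leaders-shift P singletons isolated) (cong suc (trans (#leaders-cong back) (hasShape-#leaders j (⋀ ρ) shape))))) ,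
      isolated
      where
      M = unshiftRel (⋀ ρ)
      nz′ = λ t → IsNZPartition-pullback unshift negate-unshift (nz t)
      P = ⋀-IsNZPartition (λ t → unshiftRel (ρ t)) nz′
      back : ∀ x y → shiftRel M x y ≡ ⋀ ρ x y
      back x y = cong₂ (⋀ ρ) (unshift-shift x) (unshift-shift y)
      singletons×isolated = ConstrainedSingletons-unshift {M = M} (ConstrainedSingletons-cong (λ x y → sym (back x y)) (hasShape-singletons j (⋀ ρ) shape))
      singletons = proj₁ singletons×isolated
      isolated = proj₂ singletons×isolated

  #isolatedTuples : ∀ c m j → length (isolatedTuples c m j) ≡ #shaped (suc c) m j
  #isolatedTuples c m j = trans (sym (length-map _ (isolatedTuples c m j)))
    (Enumerates-length
      (Enumerates-map (shift-correspondence c m j)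
        (Enumerates-filterᵇ newIsolatedᵗ (newIsolated-cong ∘ ⋀-cong) (shapedTuples-enumerate c (suc m) (suc j))))
      (shapedTuples-enumerate (suc c) m j))

  options : ∀ m → List (Bool × Fin m)
  options zero    = []
  options (suc m) = (true , Fin.zero) ∷ (false , Fin.zero) ∷ map (map₂ Fin.suc) (options m)

  options-enumerate : ∀ m → Enumerates (setoid (Bool × Fin m)) (λ _ → ⊤) (options m)
  options-enumerate m = record
    { sound    = All.universal _ (options m)
    ; complete = λ _ → complete′
    ; unique   = unique′ m
    }
    where
    complete′ : ∀ {m} {o : Bool × Fin m} → Any.Any (o ≡_) (options m)
    complete′ {o = true  , Fin.zero}  = here refl
    complete′ {o = false , Fin.zero}  = there (here refl)
    complete′ {o = s     , Fin.suc j} = there (there (Any.map⁺ (Any.map (cong (map₂ Fin.suc)) complete′)))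
    unique′ : ∀ m → Unique.Unique (setoid (Bool × Fin m)) (options m)
    unique′ zero    = []
    unique′ (suc m) = ((λ ()) ∷ fresh true) ∷ fresh false ∷ Unique.map⁺ (setoid _) (setoid _) suc-inj (unique′ m)
      where
      fresh : ∀ s → All.All ((s , Fin.zero) ≢_) (map (map₂ Fin.suc) (options m))
      fresh s = All.map⁺ (All.universal (λ _ ()) (options m))
      suc-inj : ∀ {o o′ : Bool × Fin m} → map₂ Fin.suc o ≡ map₂ Fin.suc o′ → o ≡ o′
      suc-inj {_ , _} {_ , _} refl = refl

  #options : ∀ {m} (q : Fin m → Bool) → length (filterᵇ (q ∘ proj₂) (options m)) ≡ count q + count q
  #options {zero}  q = refl
  #options {suc m} q = begin
    length (filterᵇ (q ∘ proj₂) (options (suc m)))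
      ≡⟨ trans (length-filterᵇ-∷ (q ∘ proj₂) _ _) (cong (indicator (q Fin.zero) +_) (length-filterᵇ-∷ (q ∘ proj₂) _ _)) ⟩
    indicator (q Fin.zero) + (indicator (q Fin.zero) + length (filterᵇ (q ∘ proj₂) (map (map₂ Fin.suc) (options m))))
      ≡⟨ cong (λ n → indicator (q Fin.zero) + (indicator (q Fin.zero) + n)) (trans (length-filterᵇ-map (q ∘ proj₂) (map₂ Fin.suc) (options m)) (#options (q ∘ Fin.suc))) ⟩
    indicator (q Fin.zero) + (indicator (q Fin.zero) + (count (q ∘ Fin.suc) + count (q ∘ Fin.suc)))
      ≡⟨ regroup (indicator (q Fin.zero)) (count (q ∘ Fin.suc)) ⟩
    count q + count q ∎
    where
    open ≡-Reasoning
    regroup : ∀ a b → a + (a + (b + b)) ≡ a + b + (a + b)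
    regroup = solve-∀

  -- d is a junk default, returned only when no free element joins the new one.
  option : ∀ {c m} → Fin m → SRel c (suc m) → Bool × Fin m
  option d M with search (joinsNew M)
  ... | just i  = signTowardNew M i , i
  ... | nothing = true , d

  option-cong : ∀ {c m} (d : Fin m) {M M′ : SRel c (suc m)} → (∀ x y → M x y ≡ M′ x y) → option d M ≡ option d M′
  option-cong d {M} {M′} M≗M′ rewrite search-cong (joinsNew-cong M≗M′) with search (joinsNew M′)
  ... | just i  = cong (_, i) (M≗M′ _ _)
  ... | nothing = refl

  -- A joined tuple is a tuple on the remaining elements together with the block (sign, leader) the new element joins.
  module Joined (c m j : ℕ) (d : Fin m) where

    Joined : Tuple c (suc m) → Set
    Joined π = Shaped c (suc m) (suc j) π × not (newIsolatedᵗ π) ≡ true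

    WithLeader : Tuple c m × (Bool × Fin m) → Set
    WithLeader (σ , (_ , y)) = Shaped c m (suc j) σ × isLeader (⋀ σ) y ≡ true

    firstJoiner : ∀ π → Joined π → Σ (Fin m) (λ y → search (joinsNew (⋀ π)) ≡ just y)
    firstJoiner π (_ , joined) with search (joinsNew (⋀ π)) in found
    ... | just y  = y , refl
    ... | nothing = ⊥-elim (true≢false (allF-intro (λ k → cong not (search-nothing (joinsNew (⋀ π)) found k))) (not-elim joined))

    joined-correspondence : Correspondence (tupleSetoid (Signed c (suc m)) r) (tupleSetoid (Signed c m) r ×ₛ setoid (Bool × Fin m))
      Joined WithLeader
    joined-correspondence = record
      { to        = λ π → (λ t → restrict (π t)) , option d (⋀ π)
      ; from      = λ (σ , (s , y)) t → extend (free s y) (σ t)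
      ; to-cong   = λ π≈π′ → (λ t x y → π≈π′ t (lift x) (lift y)) , option-cong d (⋀-cong π≈π′)
      ; from-cong = λ { {σ , (s , y)} (σ≈σ′ , refl) t a b → extendView-cong (free s y) (σ≈σ′ t) (view a) (view b) }
      ; to-P      = to-P
      ; from-Q    = from-Q
      ; from∘to   = from∘to
      ; to∘from   = to∘from
      }
      where
      to-P : ∀ {π} → Joined π → WithLeader ((λ t → restrict (π t)) , option d (⋀ π))
      to-P {π} joined@((nz , shape) , _) with firstJoiner π joined
      ... | y , found rewrite found =
        ((λ t → IsNZPartition-restrict (nz t)) ,
         hasShape-intro (suc j) (restrict M) (ConstrainedSingletons-restrict {M = M} (hasShape-singletons (suc j) M shape))
           (trans (sym (#leaders-restrict P (signTowardNew M y) y (joinsNew-sign M y (proj₁ (search-just (joinsNew M) found))) y-leads))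
             (hasShape-#leaders (suc j) M shape))) ,
        y-leads
        where
        M = ⋀ π
        P = ⋀-IsNZPartition π nz
        y-leads = firstJoiner-isLeader P found
      from-Q : ∀ {u} → WithLeader u → Joined (λ t → extend (free (proj₁ (proj₂ u)) (proj₂ (proj₂ u))) (proj₁ u t))
      from-Q {σ , (s , y)} ((nz , shape) , y-leads) =
        ((λ t → IsNZPartition-extend (free s y) (nz t)) ,
         trans (hasShape-cong (suc j) (⋀-extend (free s y) σ))
           (hasShape-intro (suc j) (extend (free s y) (⋀ σ)) (ConstrainedSingletons-extend P s y y-leads (hasShape-singletons (suc j) (⋀ σ) shape))
              (trans (#leaders-extend P s y y-leads) (hasShape-#leaders (suc j) (⋀ σ) shape)))) ,
        cong not (trans (newIsolated-cong (⋀-extend (free s y) σ)) (newIsolated-extend P s y y-leads))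
        where
        P = ⋀-IsNZPartition σ nz
      from∘to : ∀ {π} → Joined π → (λ t → extend (free (proj₁ (option d (⋀ π))) (proj₂ (option d (⋀ π)))) (restrict (π t))) ≈ᵗ π
      from∘to {π} joined@((nz , _) , _) t x y with firstJoiner π joined
      ... | y′ , found rewrite found =
        extend-restrict (nz t) (free (signTowardNew M y′) y′) (⋀-elim π (joinsNew-sign M y′ (proj₁ (search-just (joinsNew M) found))) t) x y
        where
        M = ⋀ π
      to∘from : ∀ {u} → WithLeader u → Setoid._≈_ (tupleSetoid (Signed c m) r ×ₛ setoid (Bool × Fin m))
        ((λ t → restrict (extend (free (proj₁ (proj₂ u)) (proj₂ (proj₂ u))) (proj₁ u t))) ,
         option d (⋀ (λ t → extend (free (proj₁ (proj₂ u)) (proj₂ (proj₂ u))) (proj₁ u t)))) u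
      to∘from {σ , (s , y)} ((nz , _) , y-leads) =
        (λ t → restrict-extend (free s y) (σ t)) ,
        trans (option-cong d (⋀-extend (free s y) σ))
          (trans (cong-option (search-extend P s y y-leads)) (cong (_, y) (signTowardNew-extend P s y y-leads)))
        where
        P = ⋀-IsNZPartition σ nz
        cong-option : search (joinsNew (extend (free s y) (⋀ σ))) ≡ just y → option d (extend (free s y) (⋀ σ)) ≡ (signTowardNew (extend (free s y) (⋀ σ)) y , y)
        cong-option found rewrite found = refl

    leaderOptions : Tuple c m → List (Bool × Fin m)
    leaderOptions σ = filterᵇ (isLeader (⋀ σ) ∘ proj₂) (options m)

    withLeader-enumerate : Enumerates (tupleSetoid (Signed c m) r ×ₛ setoid (Bool × Fin m)) WithLeader
      (pairs leaderOptions (shapedTuples c m (suc j)))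
    withLeader-enumerate = Enumerates-pairs leaderOptions (shapedTuples-enumerate c m (suc j))
      (λ {σ} _ → Enumerates-⇔ proj₂ (tt ,_) (Enumerates-filterᵇ (isLeader (⋀ σ) ∘ proj₂) (cong (isLeader (⋀ σ) ∘ proj₂)) (options-enumerate m)))
      (λ {_} {_} {o} σ≈σ′ leads → trans (sym (isLeader-cong (⋀-cong σ≈σ′) (proj₂ o))) leads)

    #joinedTuples : length (joinedTuples c m j) ≡ (suc j + suc j) * #shaped c m (suc j)
    #joinedTuples = begin
      length (joinedTuples c m j)
        ≡⟨ length-map _ (joinedTuples c m j) ⟨
      length (map (Correspondence.to joined-correspondence) (joinedTuples c m j))
        ≡⟨ Enumerates-length (Enumerates-map joined-correspondence
             (Enumerates-filterᵇ (not ∘ newIsolatedᵗ) (cong not ∘ newIsolated-cong ∘ ⋀-cong) (shapedTuples-enumerate c (suc m) (suc j))))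
             withLeader-enumerate ⟩
      length (pairs leaderOptions (shapedTuples c m (suc j)))
        ≡⟨ length-pairs leaderOptions (suc j + suc j) (All.map #leaderOptions (sound (shapedTuples-enumerate c m (suc j)))) ⟩
      (suc j + suc j) * #shaped c m (suc j) ∎
      where
      open ≡-Reasoning
      #leaderOptions : ∀ {σ} → Shaped c m (suc j) σ → length (leaderOptions σ) ≡ suc j + suc j
      #leaderOptions {σ} (_ , shape) = trans (#options (isLeader (⋀ σ))) (cong₂ _+_ (hasShape-#leaders (suc j) (⋀ σ) shape) (hasShape-#leaders (suc j) (⋀ σ) shape))

  #joinedTuples : ∀ c m j → length (joinedTuples c m j) ≡ (suc j + suc j) * #shaped c m (suc j)
  #joinedTuples c zero    j = begin
    length (joinedTuples c 0 j)        ≡⟨ filterᵇ-none (not ∘ newIsolatedᵗ) (All.universal (λ _ → refl) (shapedTuples c 1 (suc j))) ⟩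
    0                                  ≡⟨ *-zeroʳ (suc j + suc j) ⟨
    (suc j + suc j) * 0                ≡⟨ cong ((suc j + suc j) *_) (#shaped-0-suc c j) ⟨
    (suc j + suc j) * #shaped c 0 (suc j) ∎
    where open ≡-Reasoning
  #joinedTuples c (suc m) j = Joined.#joinedTuples c (suc m) j Fin.zero

  #shaped-formula : ∀ m c j → #shaped c m j ≡ stirling₂ᴮ m j * #shaped (c + j) 0 0
  #shaped-formula zero    c zero    = sym (trans (+-identityʳ _) (cong (λ k → #shaped k 0 0) (+-identityʳ c)))
  #shaped-formula zero    c (suc j) = #shaped-0-suc c j
  #shaped-formula (suc m) c zero    = #shaped-suc-0 c m
  #shaped-formula (suc m) c (suc j) = begin
    #shaped c (suc m) (suc j)
      ≡⟨ #shaped-split c m j ⟩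
    length (isolatedTuples c m j) + length (joinedTuples c m j)
      ≡⟨ cong₂ _+_ (#isolatedTuples c m j) (#joinedTuples c m j) ⟩
    #shaped (suc c) m j + 2j+2 * #shaped c m (suc j)
      ≡⟨ cong₂ (λ a b → a + 2j+2 * b) (#shaped-formula m (suc c) j) (#shaped-formula m c (suc j)) ⟩
    stirling₂ᴮ m j * #shaped (suc c + j) 0 0 + 2j+2 * (stirling₂ᴮ m (suc j) * X)
      ≡⟨ cong (λ k → stirling₂ᴮ m j * #shaped k 0 0 + 2j+2 * (stirling₂ᴮ m (suc j) * X)) (+-suc c j) ⟨
    stirling₂ᴮ m j * X + 2j+2 * (stirling₂ᴮ m (suc j) * X)
      ≡⟨ cong (stirling₂ᴮ m j * X +_) (*-assoc 2j+2 (stirling₂ᴮ m (suc j)) X) ⟨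
    stirling₂ᴮ m j * X + 2j+2 * stirling₂ᴮ m (suc j) * X
      ≡⟨ *-distribʳ-+ X (stirling₂ᴮ m j) (2j+2 * stirling₂ᴮ m (suc j)) ⟨
    stirling₂ᴮ (suc m) (suc j) * X ∎
    where
    open ≡-Reasoning
    2j+2 = suc j + suc j
    X = #shaped (c + suc j) 0 0

  length≡∑#fibres : ∀ {A : Set} (h : A → ℕ) K xs → All (λ a → h a < K) xs →
    length xs ≡ ∑ K (λ j → length (filterᵇ (λ a → h a ≡ᵇ j) xs))
  length≡∑#fibres h K [] [] = sym (∑ℕ.∑-0 K)
  length≡∑#fibres h K (x ∷ xs) (hx<K ∷ h<K) = sym (begin
    ∑ K (λ j → length (filterᵇ (λ a → h a ≡ᵇ j) (x ∷ xs)))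
      ≡⟨ ∑ℕ.∑-cong K (λ j → length-filterᵇ-∷ (λ a → h a ≡ᵇ j) x xs) ⟩
    ∑ K (λ j → ∑ℕ.δ (h x) j + length (filterᵇ (λ a → h a ≡ᵇ j) xs))
      ≡⟨ ∑ℕ.∑-+ K (∑ℕ.δ (h x)) (λ j → length (filterᵇ (λ a → h a ≡ᵇ j) xs)) ⟩
    ∑ K (∑ℕ.δ (h x)) + ∑ K (λ j → length (filterᵇ (λ a → h a ≡ᵇ j) xs))
      ≡⟨ cong₂ _+_ (trans (∑ℕ.∑-cong K {g = λ k → 1 * ∑ℕ.δ (h x) k} (λ k → sym (*-identityˡ _))) (∑ℕ.∑-δ K (h x) (λ _ → 1) hx<K)) (sym (length≡∑#fibres h K xs h<K)) ⟩
    suc (length xs) ∎)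
    where open ≡-Reasoning

  #tuples : ∀ n → length (tuples r 0 n) ≡ N n ^ r
  #tuples n = trans (length-allFuns r (map (toSRel {0} {n}) (BPartsNZ n))) (cong (_^ r) (length-map (toSRel {0} {n}) (BPartsNZ n)))

  N^r≡∑#shaped : ∀ n → N n ^ r ≡ ∑ (suc n) (#shaped 0 n)
  N^r≡∑#shaped n = trans (sym (#tuples n))
    (length≡∑#fibres (#leaders ∘ ⋀) (suc n) (tuples r 0 n) (All.universal (λ π → s≤s (count≤ (isLeader (⋀ π)))) (tuples r 0 n)))

  MinimallyIntersecting : ∀ {k} → Tuple k 0 → Set
  MinimallyIntersecting σ = ∀ x y → ⋀ σ x y ≡ true → x ≡ y

  minimalTuples-enumerate : ∀ n → Enumerates (tupleSetoid (Elt n) r)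
    (λ π → (∀ t → IsNZPartition (neg n) (π t)) × minimallyIntersecting n r π ≡ true)
    (filterᵇ (minimallyIntersecting n r) (allFuns r (BPartsNZ n)))
  minimalTuples-enumerate n = Enumerates-filterᵇ (minimallyIntersecting n r)
    (λ π≈π′ → allF-cong (λ x → allF-cong (λ y → cong₂ _⇒ᵇ_ (allF-cong (λ t → π≈π′ t x y)) refl)))
    (Enumerates-allFuns r (BPartsNZ-enumerate n))

  minimal-correspondence : ∀ k → Correspondence (tupleSetoid (Elt (k + 0)) r) (tupleSetoid (Signed k 0) r)
    (λ π → (∀ t → IsNZPartition (neg (k + 0)) (π t)) × minimallyIntersecting (k + 0) r π ≡ true)
    (λ σ → AllNZ σ × MinimallyIntersecting σ)
  minimal-correspondence k = record
    { to        = λ π t → toSRel (π t)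
    ; from      = λ σ t → fromSRel (σ t)
    ; to-cong   = λ π≈π′ t x y → π≈π′ t (encode x) (encode y)
    ; from-cong = λ σ≈σ′ t x y → σ≈σ′ t (decode k 0 x) (decode k 0 y)
    ; to-P      = λ {π} (nz , minimal) → (λ t → IsNZPartition-pullback encode neg-encode (nz t)) , to-minimal {π} minimal
    ; from-Q    = λ {σ} (nz , minimal) → (λ t → IsNZPartition-pullback (decode k 0) (negate-decode {k} {0}) (nz t)) , from-minimal {σ} minimal
    ; from∘to   = λ {π} _ t x y → cong₂ (π t) (encode-decode {k} {0} x) (encode-decode {k} {0} y)
    ; to∘from   = λ {σ} _ t x y → cong₂ (σ t) (decode-encode x) (decode-encode y)
    }
    where
    to-minimal : ∀ {π} → minimallyIntersecting (k + 0) r π ≡ true → MinimallyIntersecting (λ t → toSRel (π t))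
    to-minimal {π} minimal x y xy = begin
      x                         ≡⟨ decode-encode x ⟨
      decode k 0 (encode x)     ≡⟨ cong (decode k 0) (eqᵇ⇒≡ (⇒ᵇ-elim (allF-elim (allF-elim {p = λ x′ → allF (λ y′ → meet (k + 0) r π x′ y′ ⇒ᵇ eqᵇ x′ y′)} minimal (encode x)) (encode y)) xy)) ⟩
      decode k 0 (encode y)     ≡⟨ decode-encode y ⟩
      y ∎
      where open ≡-Reasoning
    from-minimal : ∀ {σ} → MinimallyIntersecting σ → minimallyIntersecting (k + 0) r (λ t → fromSRel (σ t)) ≡ true
    from-minimal minimal = allF-intro λ x → allF-intro λ y → ⇒ᵇ-intro λ xy →
      subst (λ w → eqᵇ x w ≡ true) (trans (sym (encode-decode {k} {0} x)) (trans (cong encode (minimal _ _ xy)) (encode-decode {k} {0} y))) (eqᵇ-refl x)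

  #shaped-minimal : ∀ k → #shaped k 0 0 ≡ ND k r
  #shaped-minimal k = begin
    #shaped k 0 0
      ≡⟨ Enumerates-length (Enumerates-⇔ shaped⇒minimal minimal⇒shaped (shapedTuples-enumerate k 0 0))
           (Enumerates-map (minimal-correspondence k) (minimalTuples-enumerate (k + 0))) ⟩
    length (map _ (filterᵇ (minimallyIntersecting (k + 0) r) (allFuns r (BPartsNZ (k + 0)))))
      ≡⟨ length-map _ (filterᵇ (minimallyIntersecting (k + 0) r) (allFuns r (BPartsNZ (k + 0)))) ⟩
    ND (k + 0) r
      ≡⟨ cong (λ n → ND n r) (+-identityʳ k) ⟩
    ND k r ∎
    where
    open ≡-Reasoning
    shaped⇒minimal : ∀ {σ} → Shaped k 0 0 σ → AllNZ σ × MinimallyIntersecting σ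
    shaped⇒minimal {σ} (nz , shape) = nz , minimal
      where
      singletons = hasShape-singletons 0 (⋀ σ) shape
      minimal : MinimallyIntersecting σ
      minimal (true  , inj₁ i) w xw = sym (singletons i w xw)
      minimal (false , inj₁ i) w xw = sym (ConstrainedSingletons-negate (⋀-IsNZPartition σ nz) singletons i w xw)
    minimal⇒shaped : ∀ {σ} → AllNZ σ × MinimallyIntersecting σ → Shaped k 0 0 σ
    minimal⇒shaped {σ} (nz , minimal) = nz , hasShape-intro 0 (⋀ σ) (λ i w xw → sym (minimal _ _ xw)) refl

  N^r≡∑stirling₂ᴮ·ND : ∀ n → N n ^ r ≡ ∑ (suc n) (λ j → stirling₂ᴮ n j * ND j r)
  N^r≡∑stirling₂ᴮ·ND n = trans (N^r≡∑#shaped n)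
    (∑ℕ.∑-cong (suc n) (λ j → trans (#shaped-formula n 0 j) (cong (stirling₂ᴮ n j *_) (#shaped-minimal j))))

module StirlingInversion where

  open import Data.Integer using (ℤ; +_; _+_; _*_; -_; _-_; 0ℤ; 1ℤ)
  open import Data.Integer.Properties using (+-*-commutativeSemiring; pos-+; pos-*; *-zeroʳ; *-zeroˡ; *-identityˡ; *-comm; *-assoc; +-identityʳ; +-identityˡ)
  open import Data.Integer.Tactic.RingSolver using (solve-∀)
  open import Data.Nat as ℕ using (ℕ; zero; suc; _∸_; _^_; _<_; _≤_; s<s)
  open import Data.Nat.Properties as ℕ using (≤-refl; m≤n⇒m≤1+n; +-∸-assoc; ≰⇒>; _≤?_)
  open import Relation.Binary.PropositionalEquality using (_≡_; refl; sym; trans; cong; cong₂; module ≡-Reasoning)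
  open import Relation.Nullary.Decidable using (Dec; yes; no)
  open import Defs using (s; sumℤ1)
  open import Function using (_∘_)
  open StirlingB
  module ∑ℕ = FiniteSum ℕ.+-*-commutativeSemiring
  module ∑ℤ = FiniteSum +-*-commutativeSemiring
  open ∑ℤ using (∑; δ)
  open ≡-Reasoning

  -- The inverse matrix of stirling₂ᴮ.
  stirling₁ᴮ : ℕ → ℕ → ℤ
  stirling₁ᴮ n j = + (2 ^ (n ∸ j)) * s n j

  s-vanishes : ∀ {n j} → n < j → s n j ≡ 0ℤ
  s-vanishes {zero}  {suc j} _         = refl
  s-vanishes {suc n} {suc j} (s<s n<j) rewrite s-vanishes n<j | s-vanishes (m≤n⇒m≤1+n n<j) | *-zeroʳ (+ n) = refl

  s-suc-zero : ∀ n → s (suc n) 0 ≡ 0ℤ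
  s-suc-zero zero    = refl
  s-suc-zero (suc n) rewrite s-suc-zero n | *-zeroʳ (+ suc n) = refl

  stirling₂ᴮ-vanishes : ∀ {j k} → j < k → stirling₂ᴮ j k ≡ 0
  stirling₂ᴮ-vanishes {zero}  {suc k} _         = refl
  stirling₂ᴮ-vanishes {suc j} {suc k} (s<s j<k) rewrite stirling₂ᴮ-vanishes j<k | stirling₂ᴮ-vanishes (m≤n⇒m≤1+n j<k) =
    ℕ.*-zeroʳ (suc k ℕ.+ suc k)

  stirling₁ᴮ-suc-zero : ∀ n → stirling₁ᴮ (suc n) 0 ≡ - + (n ℕ.+ n) * stirling₁ᴮ n 0
  stirling₁ᴮ-suc-zero n = begin
    + (2 ^ suc n) * (- (+ n * s n 0))       ≡⟨ cong (_* (- (+ n * s n 0))) (pos-* 2 (2 ^ n)) ⟩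
    + 2 * + (2 ^ n) * (- (+ n * s n 0))     ≡⟨ ring (+ (2 ^ n)) (s n 0) (+ n) ⟩
    - (+ n + + n) * (+ (2 ^ n) * s n 0)     ≡⟨ cong (λ k → - k * stirling₁ᴮ n 0) (pos-+ n n) ⟨
    - + (n ℕ.+ n) * stirling₁ᴮ n 0          ∎
    where
    ring : ∀ p a n → + 2 * p * (- (n * a)) ≡ - (n + n) * (p * a)
    ring = solve-∀

  stirling₁ᴮ-suc-suc : ∀ n j → stirling₁ᴮ (suc n) (suc j) ≡ stirling₁ᴮ n j - + (n ℕ.+ n) * stirling₁ᴮ n (suc j)
  stirling₁ᴮ-suc-suc n j with suc j ≤? n
  ... | yes j<n = begin
    + (2 ^ (n ∸ j)) * (s n j - + n * s n (suc j))
      ≡⟨ cong (λ k → + (2 ^ k) * (s n j - + n * s n (suc j))) (+-∸-assoc 1 j<n) ⟩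
    + (2 ℕ.* 2 ^ (n ∸ suc j)) * (s n j - + n * s n (suc j))
      ≡⟨ cong (_* (s n j - + n * s n (suc j))) (pos-* 2 (2 ^ (n ∸ suc j))) ⟩
    + 2 * + (2 ^ (n ∸ suc j)) * (s n j - + n * s n (suc j))
      ≡⟨ ring (+ (2 ^ (n ∸ suc j))) (s n j) (s n (suc j)) (+ n) ⟩
    + 2 * + (2 ^ (n ∸ suc j)) * s n j - (+ n + + n) * (+ (2 ^ (n ∸ suc j)) * s n (suc j))
      ≡⟨ cong₂ (λ p k → p * s n j - k * stirling₁ᴮ n (suc j)) (sym (pos-* 2 (2 ^ (n ∸ suc j)))) (sym (pos-+ n n)) ⟩
    + (2 ℕ.* 2 ^ (n ∸ suc j)) * s n j - + (n ℕ.+ n) * stirling₁ᴮ n (suc j)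
      ≡⟨ cong (λ k → + (2 ^ k) * s n j - + (n ℕ.+ n) * stirling₁ᴮ n (suc j)) (+-∸-assoc 1 j<n) ⟨
    stirling₁ᴮ n j - + (n ℕ.+ n) * stirling₁ᴮ n (suc j) ∎
    where
    ring : ∀ p a b n → + 2 * p * (a - n * b) ≡ + 2 * p * a - (n + n) * (p * b)
    ring = solve-∀
  ... | no j≮n rewrite s-vanishes (≰⇒> j≮n) = ring (+ (2 ^ (n ∸ j))) (s n j) (+ n) (+ (n ℕ.+ n)) (+ (2 ^ (n ∸ suc j)))
    where
    ring : ∀ p a n c q → p * (a - n * 0ℤ) ≡ p * a - c * (q * 0ℤ)
    ring = solve-∀

  δ-zero : ∀ n → + (n ℕ.+ n) * δ n 0 ≡ 0ℤ
  δ-zero zero    = refl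
  δ-zero (suc n) = *-zeroʳ (+ (suc n ℕ.+ suc n))

  -- The recursions of stirling₁ᴮ in n and of stirling₂ᴮ in k cancel, the term 2n·δ(n,k) against 2k·δ(n,k).
  orthogonality : ∀ n K k → n < K → ∑ K (λ j → stirling₁ᴮ n j * + stirling₂ᴮ j k) ≡ δ n k
  orthogonality zero (suc K) k _ = begin
    + 1 * + stirling₂ᴮ 0 k + ∑ K (λ j → 0ℤ * + stirling₂ᴮ (suc j) k) ≡⟨ cong₂ _+_ (*-identityˡ (+ stirling₂ᴮ 0 k)) (∑ℤ.∑-vanish K (λ j → *-zeroˡ (+ stirling₂ᴮ (suc j) k))) ⟩
    + stirling₂ᴮ 0 k + 0ℤ                                  ≡⟨ +-identityʳ (+ stirling₂ᴮ 0 k) ⟩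
    + stirling₂ᴮ 0 k                                       ≡⟨ T0≡δ k ⟩
    δ 0 k                                       ∎
    where
    T0≡δ : ∀ k → + stirling₂ᴮ 0 k ≡ δ 0 k
    T0≡δ zero    = refl
    T0≡δ (suc k) = refl
  orthogonality (suc n) (suc K) k (s<s n<K) = begin
    stirling₁ᴮ (suc n) 0 * T 0 + ∑ K (λ j → stirling₁ᴮ (suc n) (suc j) * T (suc j))
      ≡⟨ cong₂ _+_ (cong (_* T 0) (stirling₁ᴮ-suc-zero n)) (∑ℤ.∑-cong K (λ j → cong (_* T (suc j)) (stirling₁ᴮ-suc-suc n j))) ⟩
    - c * U 0 * T 0 + ∑ K (λ j → (U j - c * U (suc j)) * T (suc j))
      ≡⟨ cong (_+_ (- c * U 0 * T 0)) (trans (∑ℤ.∑-cong K (λ j → distrib (U j) (U (suc j)) (T (suc j)) c))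
           (trans (∑ℤ.∑-+ K (λ j → U j * T (suc j)) (λ j → - c * (U (suc j) * T (suc j))))
             (cong (_+_ A) (sym (∑ℤ.*-distribˡ-∑ K (- c) (λ j → U (suc j) * T (suc j))))))) ⟩
    - c * U 0 * T 0 + (A + - c * ∑ K (λ j → U (suc j) * T (suc j)))
      ≡⟨ regroup (U 0) (T 0) A (∑ K (λ j → U (suc j) * T (suc j))) c ⟩
    A - c * ∑ (suc K) (λ j → U j * T j)
      ≡⟨ cong (λ x → A - c * x) (orthogonality n (suc K) k (m≤n⇒m≤1+n n<K)) ⟩
    A - c * δ n k
      ≡⟨ shifted k ⟩
    δ (suc n) k ∎
    where
    U = stirling₁ᴮ n
    T = λ j → + stirling₂ᴮ j k
    A = ∑ K (λ j → U j * T (suc j))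
    c = + (n ℕ.+ n)
    distrib : ∀ u u′ t c → (u - c * u′) * t ≡ u * t + - c * (u′ * t)
    distrib = solve-∀
    regroup : ∀ u t s s′ c → - c * u * t + (s + - c * s′) ≡ s - c * (u * t + s′)
    regroup = solve-∀
    shifted : ∀ k → ∑ K (λ j → U j * + stirling₂ᴮ (suc j) k) - c * δ n k ≡ δ (suc n) k
    shifted zero = begin
      ∑ K (λ j → U j * 0ℤ) - c * δ n 0 ≡⟨ cong₂ _-_ (∑ℤ.∑-vanish K (λ j → *-zeroʳ (U j))) (δ-zero n) ⟩
      0ℤ - 0ℤ                            ∎
    shifted (suc k) = begin
      ∑ K (λ j → U j * + stirling₂ᴮ (suc j) (suc k)) - c * δ n (suc k)
        ≡⟨ cong (_- c * δ n (suc k)) (∑ℤ.∑-cong K (λ j → cong (U j *_) (trans (pos-+ (stirling₂ᴮ j k) _) (cong (_+_ (+ stirling₂ᴮ j k)) (pos-* (suc k ℕ.+ suc k) (stirling₂ᴮ j (suc k))))))) ⟩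
      ∑ K (λ j → U j * (+ stirling₂ᴮ j k + d * + stirling₂ᴮ j (suc k))) - c * δ n (suc k)
        ≡⟨ cong (_- c * δ n (suc k)) (trans (∑ℤ.∑-cong K (λ j → expand (U j) (+ stirling₂ᴮ j k) (+ stirling₂ᴮ j (suc k)) d)) (∑ℤ.∑-+ K (λ j → U j * + stirling₂ᴮ j k) (λ j → d * (U j * + stirling₂ᴮ j (suc k))))) ⟩
      ∑ K (λ j → U j * + stirling₂ᴮ j k) + ∑ K (λ j → d * (U j * + stirling₂ᴮ j (suc k))) - c * δ n (suc k)
        ≡⟨ cong (λ x → ∑ K (λ j → U j * + stirling₂ᴮ j k) + x - c * δ n (suc k)) (sym (∑ℤ.*-distribˡ-∑ K d (λ j → U j * + stirling₂ᴮ j (suc k)))) ⟩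
      ∑ K (λ j → U j * + stirling₂ᴮ j k) + d * ∑ K (λ j → U j * + stirling₂ᴮ j (suc k)) - c * δ n (suc k)
        ≡⟨ cong₂ (λ x y → x + d * y - c * δ n (suc k)) (orthogonality n K k n<K) (orthogonality n K (suc k) n<K) ⟩
      δ n k + d * δ n (suc k) - c * δ n (suc k)
        ≡⟨ cancel (n ℕ.≟ suc k) ⟩
      δ n k ∎
      where
      d = + (suc k ℕ.+ suc k)
      expand : ∀ u t t′ d → u * (t + d * t′) ≡ u * t + d * (u * t′)
      expand = solve-∀
      cancel : Dec (n ≡ suc k) → δ n k + d * δ n (suc k) - c * δ n (suc k) ≡ δ n k
      cancel (yes refl) rewrite ∑ℤ.δ-diag (suc k) = ring (δ n k) d
        where
        ring : ∀ a d → a + d * 1ℤ - d * 1ℤ ≡ a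
        ring = solve-∀
      cancel (no n≢k) rewrite ∑ℤ.δ-off n≢k = ring (δ n k) d c
        where
        ring : ∀ a d c → a + d * 0ℤ - c * 0ℤ ≡ a
        ring = solve-∀

  stirlingᴮ-inversion : (a b : ℕ → ℤ) → (∀ n → b n ≡ ∑ (suc n) (λ k → + stirling₂ᴮ n k * a k)) →
    ∀ n → ∑ (suc n) (λ j → stirling₁ᴮ n j * b j) ≡ a n
  stirlingᴮ-inversion a b b≡ n = begin
    ∑ (suc n) (λ j → stirling₁ᴮ n j * b j)
      ≡⟨ ∑ℤ.∑-cong-< (suc n) (λ j j≤n → cong (stirling₁ᴮ n j *_) (trans (b≡ j) (extend j≤n))) ⟩
    ∑ (suc n) (λ j → stirling₁ᴮ n j * ∑ (suc n) (λ k → + stirling₂ᴮ j k * a k))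
      ≡⟨ ∑ℤ.∑-cong (suc n) (λ j → ∑ℤ.*-distribˡ-∑ (suc n) (stirling₁ᴮ n j) (λ k → + stirling₂ᴮ j k * a k)) ⟩
    ∑ (suc n) (λ j → ∑ (suc n) (λ k → stirling₁ᴮ n j * (+ stirling₂ᴮ j k * a k)))
      ≡⟨ ∑ℤ.∑-swap (suc n) (suc n) (λ j k → stirling₁ᴮ n j * (+ stirling₂ᴮ j k * a k)) ⟩
    ∑ (suc n) (λ k → ∑ (suc n) (λ j → stirling₁ᴮ n j * (+ stirling₂ᴮ j k * a k)))
      ≡⟨ ∑ℤ.∑-cong (suc n) (λ k → trans (∑ℤ.∑-cong (suc n) (λ j → sym (*-assoc (stirling₁ᴮ n j) (+ stirling₂ᴮ j k) (a k))))
                                        (sym (∑ℤ.*-distribʳ-∑ (suc n) (a k) (λ j → stirling₁ᴮ n j * + stirling₂ᴮ j k)))) ⟩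
    ∑ (suc n) (λ k → ∑ (suc n) (λ j → stirling₁ᴮ n j * + stirling₂ᴮ j k) * a k)
      ≡⟨ ∑ℤ.∑-cong (suc n) (λ k → trans (cong (_* a k) (orthogonality n (suc n) k ≤-refl)) (*-comm (δ n k) (a k))) ⟩
    ∑ (suc n) (λ k → a k * δ n k)
      ≡⟨ ∑ℤ.∑-δ (suc n) n a ≤-refl ⟩
    a n ∎
    where
    extend : ∀ {j} → j < suc n → ∑ (suc j) (λ k → + stirling₂ᴮ j k * a k) ≡ ∑ (suc n) (λ k → + stirling₂ᴮ j k * a k)
    extend {j} j≤n = ∑ℤ.∑-extend (λ k → + stirling₂ᴮ j k * a k) j≤n
      (λ k j<k → trans (cong (λ t → + t * a k) (stirling₂ᴮ-vanishes j<k)) (*-zeroˡ (a k)))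

  +-∑ : ∀ K (f : ℕ → ℕ) → + ∑ℕ.∑ K f ≡ ∑ K (λ j → + f j)
  +-∑ zero    f = refl
  +-∑ (suc K) f = trans (pos-+ (f 0) (∑ℕ.∑ K (f ∘ suc))) (cong (_+_ (+ f 0)) (+-∑ K (f ∘ suc)))

  -- For n ≥ 1 the j = 0 term vanishes, as s(n, 0) = 0.
  stirlingᴮ-inversionℕ : (a b : ℕ → ℕ) → (∀ n → b n ≡ ∑ℕ.∑ (suc n) (λ k → stirling₂ᴮ n k ℕ.* a k)) →
    ∀ n → 1 ≤ n → + a n ≡ sumℤ1 n (λ j → + b j * stirling₁ᴮ n j)
  stirlingᴮ-inversionℕ a b b≡ (suc n) _ = begin
    + a (suc n)
      ≡⟨ stirlingᴮ-inversion (+_ ∘ a) (+_ ∘ b) b≡ℤ (suc n) ⟨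
    ∑ (suc (suc n)) (λ j → stirling₁ᴮ (suc n) j * + b j)
      ≡⟨ ∑ℤ.∑-cong (suc (suc n)) (λ j → *-comm (stirling₁ᴮ (suc n) j) (+ b j)) ⟩
    + b 0 * stirling₁ᴮ (suc n) 0 + ∑ (suc n) (λ j → + b (suc j) * stirling₁ᴮ (suc n) (suc j))
      ≡⟨ cong (_+ ∑ (suc n) (λ j → + b (suc j) * stirling₁ᴮ (suc n) (suc j))) (trans (cong (λ x → + b 0 * (+ (2 ^ suc n) * x)) (s-suc-zero n))
           (trans (cong (+ b 0 *_) (*-zeroʳ (+ (2 ^ suc n)))) (*-zeroʳ (+ b 0)))) ⟩
    0ℤ + ∑ (suc n) (λ j → + b (suc j) * stirling₁ᴮ (suc n) (suc j))
      ≡⟨ +-identityˡ _ ⟩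
    ∑ (suc n) (λ j → + b (suc j) * stirling₁ᴮ (suc n) (suc j))
      ≡⟨ ∑ℤ.foldr-applyUpTo (suc n) (λ j → + b (suc j) * stirling₁ᴮ (suc n) (suc j)) (λ i → i) ⟨
    sumℤ1 (suc n) (λ j → + b j * stirling₁ᴮ (suc n) j) ∎
    where
    b≡ℤ : ∀ n → + b n ≡ ∑ (suc n) (λ k → + stirling₂ᴮ n k * + a k)
    b≡ℤ n = trans (cong +_ (b≡ n)) (trans (+-∑ (suc n) (λ k → stirling₂ᴮ n k ℕ.* a k)) (∑ℤ.∑-cong (suc n) (λ k → pos-* (stirling₂ᴮ n k) (a k))))

module StirlingConvolution where

  open import Data.Nat using (ℕ; zero; suc; _+_; _*_; _∸_; _^_; _!; _≤_; s<s)
  open import Data.Nat.Combinatorics using (_C_; nCk≡n!/k![n-k]!; k>n⇒nCk≡0; k![n∸k]!∣n!; nCk+nC[k+1]≡[n+1]C[k+1])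
  open import Data.Nat.DivMod using (m/n*n≡m)
  open import Data.Nat.Properties using (+-*-commutativeSemiring; *-zeroʳ; +-identityʳ; ≤-pred; n≤1+n; +-∸-assoc; _!≢0; m*n≢0)
  open import Data.Nat.Tactic.RingSolver using (solve-∀)
  open import Relation.Binary.PropositionalEquality using (_≡_; refl; sym; trans; cong; cong₂; module ≡-Reasoning)
  open StirlingB
  module ∑ℕ = FiniteSum +-*-commutativeSemiring
  open ∑ℕ using (∑)
  open ≡-Reasoning

  nCk*k!*[n∸k]!≡n! : ∀ {n k} → k ≤ n → (n C k) * (k ! * (n ∸ k) !) ≡ n !
  nCk*k!*[n∸k]!≡n! {n} {k} k≤n = trans (cong (_* (k ! * (n ∸ k) !)) (nCk≡n!/k![n-k]! k≤n)) (m/n*n≡m (k![n∸k]!∣n! k≤n))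
    where instance _ = m*n≢0 (k !) ((n ∸ k) !) {{k !≢0}} {{(n ∸ k) !≢0}}

  -- ∑_{i ≤ m} C(m+1, i+1) 2^i stirling₂ᴮ(m-i, k): the element m+1 and i others form a block pair with 2^i sign patterns.
  convolution : ℕ → ℕ → ℕ
  convolution m k = ∑ (suc m) (λ i → (suc m C suc i) * 2 ^ i * stirling₂ᴮ (m ∸ i) k)

  private
    pascal-part : ∀ m k → ∑ (suc (suc m)) (λ i → (suc m C i) * 2 ^ i * stirling₂ᴮ (suc m ∸ i) k) ≡ stirling₂ᴮ (suc m) k + 2 * convolution m k
    pascal-part m k = cong₂ _+_ (+-identityʳ (stirling₂ᴮ (suc m) k))
      (trans (∑ℕ.∑-cong (suc m) (λ i → ring (suc m C suc i) (2 ^ i) (stirling₂ᴮ (m ∸ i) k)))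
             (sym (∑ℕ.*-distribˡ-∑ (suc m) 2 (λ i → (suc m C suc i) * 2 ^ i * stirling₂ᴮ (m ∸ i) k))))
      where
      ring : ∀ b p t → b * (2 * p) * t ≡ 2 * (b * p * t)
      ring = solve-∀

    shifted-part : ∀ m k → ∑ (suc (suc m)) (λ i → (suc m C suc i) * 2 ^ i * stirling₂ᴮ (suc m ∸ i) k) ≡
      ∑ (suc m) (λ i → (suc m C suc i) * 2 ^ i * stirling₂ᴮ (suc (m ∸ i)) k)
    shifted-part m k = sym (trans (∑ℕ.∑-cong-< (suc m) (λ i i<1+m → cong (λ l → (suc m C suc i) * 2 ^ i * stirling₂ᴮ l k) (sym (+-∸-assoc 1 (≤-pred i<1+m)))))
      (∑ℕ.∑-extend (λ i → (suc m C suc i) * 2 ^ i * stirling₂ᴮ (suc m ∸ i) k) (n≤1+n (suc m))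
        (λ i m<i → cong (λ c → c * 2 ^ i * stirling₂ᴮ (suc m ∸ i) k) (k>n⇒nCk≡0 (s<s m<i)))))

  convolution≡ : ∀ m k → convolution m k ≡ suc k * stirling₂ᴮ (suc m) (suc k)
  convolution≡ zero    zero    = refl
  convolution≡ zero    (suc k) = sym (trans (cong (suc (suc k) *_) (*-zeroʳ (suc (suc k) + suc (suc k)))) (*-zeroʳ (suc (suc k))))
  convolution≡ (suc m) k = begin
    ∑ (suc (suc m)) (λ i → (suc (suc m) C suc i) * 2 ^ i * stirling₂ᴮ (suc m ∸ i) k)
      ≡⟨ ∑ℕ.∑-cong (suc (suc m)) (λ i → trans (cong (λ c → c * 2 ^ i * stirling₂ᴮ (suc m ∸ i) k) (sym (nCk+nC[k+1]≡[n+1]C[k+1] (suc m) i)))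
                                                (distrib (suc m C i) (suc m C suc i) (2 ^ i) (stirling₂ᴮ (suc m ∸ i) k))) ⟩
    ∑ (suc (suc m)) (λ i → (suc m C i) * 2 ^ i * stirling₂ᴮ (suc m ∸ i) k + (suc m C suc i) * 2 ^ i * stirling₂ᴮ (suc m ∸ i) k)
      ≡⟨ ∑ℕ.∑-+ (suc (suc m)) (λ i → (suc m C i) * 2 ^ i * stirling₂ᴮ (suc m ∸ i) k) (λ i → (suc m C suc i) * 2 ^ i * stirling₂ᴮ (suc m ∸ i) k) ⟩
    ∑ (suc (suc m)) (λ i → (suc m C i) * 2 ^ i * stirling₂ᴮ (suc m ∸ i) k) + ∑ (suc (suc m)) (λ i → (suc m C suc i) * 2 ^ i * stirling₂ᴮ (suc m ∸ i) k)
      ≡⟨ cong₂ _+_ (pascal-part m k) (shifted-part m k) ⟩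
    stirling₂ᴮ (suc m) k + 2 * convolution m k + ∑ (suc m) (λ i → (suc m C suc i) * 2 ^ i * stirling₂ᴮ (suc (m ∸ i)) k)
      ≡⟨ close k ⟩
    suc k * stirling₂ᴮ (suc (suc m)) (suc k) ∎
    where
    distrib : ∀ a b p t → (a + b) * p * t ≡ a * p * t + b * p * t
    distrib = solve-∀
    close : ∀ k → stirling₂ᴮ (suc m) k + 2 * convolution m k + ∑ (suc m) (λ i → (suc m C suc i) * 2 ^ i * stirling₂ᴮ (suc (m ∸ i)) k)
                  ≡ suc k * stirling₂ᴮ (suc (suc m)) (suc k)
    close zero rewrite ∑ℕ.∑-vanish (suc m) (λ i → *-zeroʳ ((suc m C suc i) * 2 ^ i)) | convolution≡ m zero =
      ring (stirling₂ᴮ (suc m) 0) (stirling₂ᴮ (suc m) 1)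
      where
      ring : ∀ x y → x + 2 * (1 * y) + 0 ≡ 1 * (x + 2 * y)
      ring = solve-∀
    close (suc k) = begin
      stirling₂ᴮ (suc m) (suc k) + 2 * convolution m (suc k) + ∑ (suc m) (λ i → b i * stirling₂ᴮ (suc (m ∸ i)) (suc k))
        ≡⟨ cong (stirling₂ᴮ (suc m) (suc k) + 2 * convolution m (suc k) +_)
             (trans (∑ℕ.∑-cong (suc m) (λ i → expand (b i) (stirling₂ᴮ (m ∸ i) k) (stirling₂ᴮ (m ∸ i) (suc k)) (suc k + suc k)))
               (trans (∑ℕ.∑-+ (suc m) (λ i → b i * stirling₂ᴮ (m ∸ i) k) (λ i → (suc k + suc k) * (b i * stirling₂ᴮ (m ∸ i) (suc k))))
                 (cong (convolution m k +_) (sym (∑ℕ.*-distribˡ-∑ (suc m) (suc k + suc k) (λ i → b i * stirling₂ᴮ (m ∸ i) (suc k))))))) ⟩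
      stirling₂ᴮ (suc m) (suc k) + 2 * convolution m (suc k) + (convolution m k + (suc k + suc k) * convolution m (suc k))
        ≡⟨ cong₂ (λ u v → stirling₂ᴮ (suc m) (suc k) + 2 * u + (v + (suc k + suc k) * u)) (convolution≡ m (suc k)) (convolution≡ m k) ⟩
      x + 2 * ((2 + k) * y) + ((1 + k) * x + ((1 + k) + (1 + k)) * ((2 + k) * y))
        ≡⟨ ring k x y ⟩
      (2 + k) * (x + ((2 + k) + (2 + k)) * y) ∎
      where
      b = λ i → (suc m C suc i) * 2 ^ i
      x = stirling₂ᴮ (suc m) (suc k)
      y = stirling₂ᴮ (suc m) (suc (suc k))
      expand : ∀ b t t′ d → b * (t + d * t′) ≡ b * t + d * (b * t′)
      expand = solve-∀
      ring : ∀ k x y → x + 2 * ((2 + k) * y) + ((1 + k) * x + ((1 + k) + (1 + k)) * ((2 + k) * y)) ≡ (2 + k) * (x + ((2 + k) + (2 + k)) * y)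
      ring = solve-∀

module ExponentialGeneratingFunction where

  open import Algebra.Bundles using (CommutativeRing)
  open import Data.Integer as ℤ using (+_)
  import Data.Integer.Properties as ℤ
  open import Data.Nat as ℕ using (ℕ; zero; suc; _∸_; _^_; _<_; s≤s; _!; NonZero)
  import Data.Nat.Properties as ℕ
  open import Data.Nat.Properties using (_!≢0; m*n≢0)
  open import Data.Nat.Tactic.RingSolver using (solve-∀)
  open import Function using (_∘_)
  open import Data.Rational as ℚ using (ℚ; 0ℚ; _+_; _*_)
  import Data.Rational.Properties as ℚ
  open import Data.Rational.Unnormalised as ℚᵘ using (mkℚᵘ; *≡*)
  import Data.Rational.Unnormalised.Properties as ℚᵘ
  open import Relation.Binary.PropositionalEquality using (_≡_; refl; sym; trans; cong; cong₂; module ≡-Reasoning)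
  open import Defs using (powS; halfExp2xMinus1; composeS; egf; sumℚ0)
  open StirlingB
  open import Data.Nat.Combinatorics using (_C_)
  open StirlingConvolution using (nCk*k!*[n∸k]!≡n!; convolution≡)
  module ∑ℕ = FiniteSum ℕ.+-*-commutativeSemiring
  module ∑ℚ = FiniteSum (CommutativeRing.commutativeSemiring ℚ.+-*-commutativeRing)
  open ∑ℚ using (∑)
  open ≡-Reasoning

  frac : ℕ → (d : ℕ) → .{{NonZero d}} → ℚ
  frac a d = (+ a) ℚ./ d

  private
    toℚᵘ-frac : ∀ a d .{{_ : NonZero d}} → ℚ.toℚᵘ (frac a d) ℚᵘ.≃ ((+ a) ℚᵘ./ d)
    toℚᵘ-frac a (suc d) = ℚ.toℚᵘ-fromℚᵘ (mkℚᵘ (+ a) d)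

  frac-cong : ∀ a b d e .{{_ : NonZero d}} .{{_ : NonZero e}} → a ℕ.* e ≡ b ℕ.* d → frac a d ≡ frac b e
  frac-cong a b (suc d) (suc e) ae≡bd = ℚ.toℚᵘ-injective (ℚᵘ.≃-trans (toℚᵘ-frac a (suc d))
    (ℚᵘ.≃-trans (*≡* (trans (sym (ℤ.pos-* a (suc e))) (trans (cong +_ ae≡bd) (ℤ.pos-* b (suc d))))) (ℚᵘ.≃-sym (toℚᵘ-frac b (suc e)))))

  frac-* : ∀ a b d e .{{_ : NonZero d}} .{{_ : NonZero e}} → frac a d * frac b e ≡ frac (a ℕ.* b) (d ℕ.* e) {{m*n≢0 d e}}
  frac-* a b (suc d) (suc e) = ℚ.toℚᵘ-injective (ℚᵘ.≃-trans (ℚ.toℚᵘ-homo-* (frac a (suc d)) (frac b (suc e)))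
    (ℚᵘ.≃-trans (ℚᵘ.*-cong (toℚᵘ-frac a (suc d)) (toℚᵘ-frac b (suc e)))
      (ℚᵘ.≃-trans (*≡* (cong (ℤ._* (+ suc (e ℕ.+ d ℕ.* suc e))) (sym (ℤ.pos-* a b)))) (ℚᵘ.≃-sym (toℚᵘ-frac (a ℕ.* b) (suc d ℕ.* suc e))))))

  frac-+ : ∀ a b d .{{_ : NonZero d}} → frac a d + frac b d ≡ frac (a ℕ.+ b) d
  frac-+ a b d@(suc d-1) = trans (ℚ.toℚᵘ-injective (ℚᵘ.≃-trans (ℚ.toℚᵘ-homo-+ (frac a d) (frac b d))
    (ℚᵘ.≃-trans (ℚᵘ.+-cong (toℚᵘ-frac a d) (toℚᵘ-frac b d))
      (ℚᵘ.≃-trans (*≡* (cong (ℤ._* (+ suc (d-1 ℕ.+ d-1 ℕ.* d))) sum≡)) (ℚᵘ.≃-sym (toℚᵘ-frac (a ℕ.* d ℕ.+ b ℕ.* d) (d ℕ.* d)))))))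
    (frac-cong (a ℕ.* d ℕ.+ b ℕ.* d) (a ℕ.+ b) (d ℕ.* d) d (ring a b d))
    where
    sum≡ : + a ℤ.* + d ℤ.+ + b ℤ.* + d ≡ + (a ℕ.* d ℕ.+ b ℕ.* d)
    sum≡ = trans (cong₂ ℤ._+_ (sym (ℤ.pos-* a d)) (sym (ℤ.pos-* b d))) (sym (ℤ.pos-+ (a ℕ.* d) (b ℕ.* d)))
    ring : ∀ a b d → (a ℕ.* d ℕ.+ b ℕ.* d) ℕ.* d ≡ (a ℕ.+ b) ℕ.* (d ℕ.* d)
    ring = solve-∀

  ∑-frac : ∀ K (f : ℕ → ℕ) d .{{_ : NonZero d}} → ∑ K (λ i → frac (f i) d) ≡ frac (∑ℕ.∑ K f) d
  ∑-frac zero    f d = sym (ℚ.0/n≡0 d)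
  ∑-frac (suc K) f d = trans (cong (_+_ (frac (f 0) d)) (∑-frac K (f ∘ suc) d)) (frac-+ (f 0) (∑ℕ.∑ K (f ∘ suc)) d)

  sumℚ0≡∑ : ∀ m f → sumℚ0 m f ≡ ∑ (suc m) f
  sumℚ0≡∑ m f = ∑ℚ.foldr-applyUpTo (suc m) f (λ i → i)

  halfExp2xMinus1-suc : ∀ i → halfExp2xMinus1 (suc i) ≡ frac (2 ^ i) (suc i !) {{suc i !≢0}}
  halfExp2xMinus1-suc i = begin
    frac 1 2 * (frac (2 ^ suc i) (suc i !) {{suc i !≢0}} ℚ.- 0ℚ)
      ≡⟨ cong (frac 1 2 *_) (ℚ.+-identityʳ (frac (2 ^ suc i) (suc i !) {{suc i !≢0}})) ⟩
    frac 1 2 * frac (2 ^ suc i) (suc i !) {{suc i !≢0}}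
      ≡⟨ frac-* 1 (2 ^ suc i) 2 (suc i !) {{_}} {{suc i !≢0}} ⟩
    frac (1 ℕ.* 2 ^ suc i) (2 ℕ.* suc i !) {{m*n≢0 2 (suc i !) {{_}} {{suc i !≢0}}}}
      ≡⟨ frac-cong (1 ℕ.* 2 ^ suc i) (2 ^ i) (2 ℕ.* suc i !) (suc i !) {{m*n≢0 2 (suc i !) {{_}} {{suc i !≢0}}}} {{suc i !≢0}} (ring (2 ^ i) (suc i !)) ⟩
    frac (2 ^ i) (suc i !) {{suc i !≢0}} ∎
    where
    ring : ∀ p f → 1 ℕ.* (2 ℕ.* p) ℕ.* f ≡ p ℕ.* (2 ℕ.* f)
    ring = solve-∀

  powS-halfExp2xMinus1 : ∀ k m → powS halfExp2xMinus1 k m ≡ frac (k ! ℕ.* stirling₂ᴮ m k) (m !) {{m !≢0}}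
  powS-halfExp2xMinus1 zero    zero    = refl
  powS-halfExp2xMinus1 zero    (suc m) = sym (ℚ.0/n≡0 (suc m !) {{suc m !≢0}})
  powS-halfExp2xMinus1 (suc k) m = begin
    sumℚ0 m (λ i → G i * powS G k (m ∸ i))
      ≡⟨ sumℚ0≡∑ m (λ i → G i * powS G k (m ∸ i)) ⟩
    0ℚ * powS G k m + ∑ m (λ i → G (suc i) * powS G k (m ∸ suc i))
      ≡⟨ trans (cong (_+ ∑ m (λ i → G (suc i) * powS G k (m ∸ suc i))) (ℚ.*-zeroˡ (powS G k m))) (ℚ.+-identityˡ _) ⟩
    ∑ m (λ i → G (suc i) * powS G k (m ∸ suc i))
      ≡⟨ tail m ⟩
    frac (suc k ! ℕ.* stirling₂ᴮ m (suc k)) (m !) {{m !≢0}} ∎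
    where
    G = halfExp2xMinus1
    tail : ∀ m → ∑ m (λ i → G (suc i) * powS G k (m ∸ suc i)) ≡ frac (suc k ! ℕ.* stirling₂ᴮ m (suc k)) (m !) {{m !≢0}}
    tail zero = sym (trans (cong (λ n → frac n 1) (ℕ.*-zeroʳ (suc k !))) (ℚ.0/n≡0 1))
    tail (suc m) = begin
      ∑ (suc m) (λ i → G (suc i) * powS G k (m ∸ i))
        ≡⟨ ∑ℚ.∑-cong-< (suc m) (λ i i<1+m → term i i<1+m) ⟩
      ∑ (suc m) (λ i → frac (F i) (suc m !) {{suc m !≢0}})
        ≡⟨ ∑-frac (suc m) F (suc m !) {{suc m !≢0}} ⟩
      frac (∑ℕ.∑ (suc m) F) (suc m !) {{suc m !≢0}}
        ≡⟨ cong (λ n → frac n (suc m !) {{suc m !≢0}}) ∑F ⟩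
      frac (suc k ! ℕ.* stirling₂ᴮ (suc m) (suc k)) (suc m !) {{suc m !≢0}} ∎
      where
      F : ℕ → ℕ
      F i = 2 ^ i ℕ.* (k ! ℕ.* stirling₂ᴮ (m ∸ i) k) ℕ.* (suc m C suc i)
      term : ∀ i → i < suc m → G (suc i) * powS G k (m ∸ i) ≡ frac (F i) (suc m !) {{suc m !≢0}}
      term i (s≤s i≤m) = begin
        G (suc i) * powS G k (m ∸ i)
          ≡⟨ cong₂ _*_ (halfExp2xMinus1-suc i) (powS-halfExp2xMinus1 k (m ∸ i)) ⟩
        frac (2 ^ i) (suc i !) {{suc i !≢0}} * frac (k ! ℕ.* stirling₂ᴮ (m ∸ i) k) ((m ∸ i) !) {{(m ∸ i) !≢0}}
          ≡⟨ frac-* (2 ^ i) (k ! ℕ.* stirling₂ᴮ (m ∸ i) k) (suc i !) ((m ∸ i) !) {{suc i !≢0}} {{(m ∸ i) !≢0}} ⟩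
        frac x (suc i ! ℕ.* (m ∸ i) !) {{d≢0}}
          ≡⟨ frac-cong x (F i) (suc i ! ℕ.* (m ∸ i) !) (suc m !) {{d≢0}} {{suc m !≢0}}
               (trans (cong (x ℕ.*_) (sym (nCk*k!*[n∸k]!≡n! (s≤s i≤m)))) (ring x (suc m C suc i) (suc i !) ((m ∸ i) !))) ⟩
        frac (F i) (suc m !) {{suc m !≢0}} ∎
        where
        x = 2 ^ i ℕ.* (k ! ℕ.* stirling₂ᴮ (m ∸ i) k)
        d≢0 = m*n≢0 (suc i !) ((m ∸ i) !) {{suc i !≢0}} {{(m ∸ i) !≢0}}
        ring : ∀ x c f g → x ℕ.* (c ℕ.* (f ℕ.* g)) ≡ x ℕ.* c ℕ.* (f ℕ.* g)
        ring = solve-∀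
      ∑F : ∑ℕ.∑ (suc m) F ≡ suc k ! ℕ.* stirling₂ᴮ (suc m) (suc k)
      ∑F = begin
        ∑ℕ.∑ (suc m) F
          ≡⟨ ∑ℕ.∑-cong (suc m) (λ i → ring₁ (2 ^ i) (k !) (stirling₂ᴮ (m ∸ i) k) (suc m C suc i)) ⟩
        ∑ℕ.∑ (suc m) (λ i → k ! ℕ.* ((suc m C suc i) ℕ.* 2 ^ i ℕ.* stirling₂ᴮ (m ∸ i) k))
          ≡⟨ ∑ℕ.*-distribˡ-∑ (suc m) (k !) (λ i → (suc m C suc i) ℕ.* 2 ^ i ℕ.* stirling₂ᴮ (m ∸ i) k) ⟨
        k ! ℕ.* StirlingConvolution.convolution m k
          ≡⟨ cong (k ! ℕ.*_) (convolution≡ m k) ⟩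
        k ! ℕ.* (suc k ℕ.* stirling₂ᴮ (suc m) (suc k))
          ≡⟨ ring₂ (k !) k (stirling₂ᴮ (suc m) (suc k)) ⟩
        suc k ! ℕ.* stirling₂ᴮ (suc m) (suc k) ∎
        where
        ring₁ : ∀ p f t c → p ℕ.* (f ℕ.* t) ℕ.* c ≡ f ℕ.* (c ℕ.* p ℕ.* t)
        ring₁ = solve-∀
        ring₂ : ∀ f k t → f ℕ.* (suc k ℕ.* t) ≡ (suc k ℕ.* f) ℕ.* t
        ring₂ = solve-∀

  compose-egf : (a b : ℕ → ℕ) → (∀ n → b n ≡ ∑ℕ.∑ (suc n) (λ j → stirling₂ᴮ n j ℕ.* a j)) →
    ∀ m → composeS (egf a) halfExp2xMinus1 m ≡ egf b m
  compose-egf a b b≡ m = begin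
    composeS (egf a) halfExp2xMinus1 m
      ≡⟨ sumℚ0≡∑ m (λ k → egf a k * powS halfExp2xMinus1 k m) ⟩
    ∑ (suc m) (λ k → egf a k * powS halfExp2xMinus1 k m)
      ≡⟨ ∑ℚ.∑-cong (suc m) term ⟩
    ∑ (suc m) (λ k → frac (stirling₂ᴮ m k ℕ.* a k) (m !) {{m !≢0}})
      ≡⟨ ∑-frac (suc m) (λ k → stirling₂ᴮ m k ℕ.* a k) (m !) {{m !≢0}} ⟩
    frac (∑ℕ.∑ (suc m) (λ k → stirling₂ᴮ m k ℕ.* a k)) (m !) {{m !≢0}}
      ≡⟨ cong (λ n → frac n (m !) {{m !≢0}}) (b≡ m) ⟨
    egf b m ∎
    where
    term : ∀ k → egf a k * powS halfExp2xMinus1 k m ≡ frac (stirling₂ᴮ m k ℕ.* a k) (m !) {{m !≢0}}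
    term k = begin
      egf a k * powS halfExp2xMinus1 k m
        ≡⟨ cong (egf a k *_) (powS-halfExp2xMinus1 k m) ⟩
      frac (a k) (k !) {{k !≢0}} * frac (k ! ℕ.* stirling₂ᴮ m k) (m !) {{m !≢0}}
        ≡⟨ frac-* (a k) (k ! ℕ.* stirling₂ᴮ m k) (k !) (m !) {{k !≢0}} {{m !≢0}} ⟩
      frac (a k ℕ.* (k ! ℕ.* stirling₂ᴮ m k)) (k ! ℕ.* m !) {{m*n≢0 (k !) (m !) {{k !≢0}} {{m !≢0}}}}
        ≡⟨ frac-cong (a k ℕ.* (k ! ℕ.* stirling₂ᴮ m k)) (stirling₂ᴮ m k ℕ.* a k) (k ! ℕ.* m !) (m !) {{m*n≢0 (k !) (m !) {{k !≢0}} {{m !≢0}}}} {{m !≢0}}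
             (ring (a k) (k !) (stirling₂ᴮ m k) (m !)) ⟩
      frac (stirling₂ᴮ m k ℕ.* a k) (m !) {{m !≢0}} ∎
      where
      ring : ∀ a f t g → a ℕ.* (f ℕ.* t) ℕ.* g ≡ t ℕ.* a ℕ.* (f ℕ.* g)
      ring = solve-∀

open import Defs using (N; ND; sumℤ1; s; composeS; MD; halfExp2xMinus1; egf)
open import Data.Nat using (ℕ; suc; _≤_; _^_; _∸_)
open import Data.Integer using (+_; _*_)
open import Data.Product using (_×_; _,_)
open import Relation.Binary.PropositionalEquality using (_≡_)

corollary3p5 : (r : ℕ) → 2 ≤ r →
    ((n : ℕ) → 1 ≤ n →
      + ND n r ≡ sumℤ1 n (λ j → (+ (N j ^ r)) * ((+ (2 ^ (n ∸ j))) * s n j)))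
    × ((m : ℕ) → composeS (MD r) halfExp2xMinus1 m ≡ egf (λ n → N n ^ r) m)
corollary3p5 (suc r′) _ =
  StirlingInversion.stirlingᴮ-inversionℕ ND′ N^r (Counting.N^r≡∑stirling₂ᴮ·ND r′) ,
  ExponentialGeneratingFunction.compose-egf ND′ N^r (Counting.N^r≡∑stirling₂ᴮ·ND r′)
  where
  ND′ = λ j → ND j (suc r′)
  N^r = λ j → N j ^ suc r′
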